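{- In the Lie algebra of type $B_r$ with $r>3$, let $\ell$ be an odd positive integer and $j,k$ integers with $j\ge 0$, $k>0$ and $\ell-1-4j-6k\ge 0$. Then $\left|\mathcal{A}(\ell\varpi_1,(\ell-1-4j-6k)\varpi_1+2j\varpi_2+2k\varpi_3)\right|=2F_r$, where $F_n$ is the $n$-th Fibonacci number ($F_1=F_2=1$, $F_n=F_{n-1}+F_{n-2}$ for $n\ge3$).
   Context: Type $B_r$ in $\mathbb{R}^r$: simple roots $\alpha_i=\varepsilon_i-\varepsilon_{i+1}$ ($i<r$), $\alpha_r=\varepsilon_r$; positive roots $\varepsilon_i\pm\varepsilon_j$ ($i<j$), $\varepsilon_i$. Fundamental weights $\varpi_i=\varepsilon_1+\cdots+\varepsilon_i$ ($i<r$), $\varpi_r=\frac12(\varepsilon_1+\cdots+\varepsilon_r)$; $\rho=\varpi_1+\cdots+\varpi_r$. $W$ is the Weyl group generated by simple reflections $s_1,\dots,s_r$. Kostant's partition function $\wp(\xi)$ counts the ways to write $\xi$ as a nonnegative integral combination of positive roots; $\mathcal{A}(\lambda,\mu)=\{\sigma\in W:\wp(\sigma(\lambda+\rho)-(\mu+\rho))>0\}$. -}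

module Defs where

open import Data.Nat as ℕ using (ℕ; zero; suc; _≡ᵇ_; _<ᵇ_)
open import Data.Integer using (+_)
open import Data.Rational as ℚ using (ℚ; 0ℚ; 1ℚ; ½; _+_; _-_; _*_; -_)
open import Data.Fin using (Fin; toℕ)
open import Data.Vec using (Vec; []; _∷_; tabulate; zipWith; replicate; foldr)
open import Data.List using (List; []; _∷_; length)
open import Data.List.Relation.Unary.All using (All)
open import Data.List.Relation.Unary.AllPairs using (AllPairs)
open import Data.List.Membership.Propositional using (_∈_)
open import Data.Bool using (if_then_else_)
open import Data.Product using (Σ; ∃; ∃-syntax; _×_; _,_)
open import Data.Sum using (_⊎_)
open import Relation.Binary.PropositionalEquality using (_≡_)
open import Relation.Nullary using (¬_)

ℕtoℚ : ℕ → ℚ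
ℕtoℚ n = (+ n) ℚ./ 1

-- Vectors in ℚ^r (the ambient space ℝ^r of the root system; all data are rational).
V : ℕ → Set
V r = Vec ℚ r

_⊕_ : ∀ {r} → V r → V r → V r
_⊕_ = zipWith _+_

_⊖_ : ∀ {r} → V r → V r → V r
_⊖_ = zipWith _-_

_·_ : ∀ {r} → ℚ → V r → V r
c · v = Data.Vec.map (c *_) v

𝟘 : ∀ {r} → V r
𝟘 = replicate _ 0ℚ

vsum : ∀ {r} → List (V r) → V r
vsum [] = 𝟘
vsum (x ∷ xs) = x ⊕ vsum xs

⟨_,_⟩ : ∀ {r} → V r → V r → ℚ
⟨ u , v ⟩ = foldr _ _+_ 0ℚ (zipWith _*_ u v)

ε : ∀ {r} → Fin r → V r
ε i = tabulate λ j → if toℕ j ≡ᵇ toℕ i then 1ℚ else 0ℚ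

-- Simple roots of B_r, indexed by Fin r (0-based: index i corresponds to α_{i+1}):
-- α_i = ε_i - ε_{i+1} for i < r, α_r = ε_r.
simpleRoot : (r : ℕ) → Fin r → V r
simpleRoot r i = tabulate λ j →
  if suc (toℕ i) ≡ᵇ r
  then (if toℕ j ≡ᵇ toℕ i then 1ℚ else 0ℚ)
  else (if toℕ j ≡ᵇ toℕ i then 1ℚ
        else (if toℕ j ≡ᵇ suc (toℕ i) then - 1ℚ else 0ℚ))

-- Simple coroots α^∨ = 2α/⟨α,α⟩ : α_i for i < r (⟨α,α⟩ = 2), 2ε_r for α_r (⟨α,α⟩ = 1).
simpleCoroot : (r : ℕ) → Fin r → V r
simpleCoroot r i =
  if suc (toℕ i) ≡ᵇ r then (ℕtoℚ 2 · simpleRoot r i) else simpleRoot r i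

s : (r : ℕ) → Fin r → V r → V r
s r i v = v ⊖ (⟨ v , simpleCoroot r i ⟩ · simpleRoot r i)

-- Elements of the Weyl group W are represented by words in the simple
-- reflections; the word i₁ ∷ … ∷ iₙ ∷ [] denotes s_{i₁} ⋯ s_{iₙ}.
Word : ℕ → Set
Word r = List (Fin r)

act : (r : ℕ) → Word r → V r → V r
act r [] v = v
act r (i ∷ w) v = s r i (act r w v)

_≈W_ : ∀ {r} → Word r → Word r → Set
_≈W_ {r} w w' = ∀ v → act r w v ≡ act r w' v

IsPosRoot : ∀ {r} → V r → Set
IsPosRoot {r} β =
  (∃[ i ] ∃[ j ] ((toℕ i ℕ.< toℕ j) × ((β ≡ ε i ⊖ ε j) ⊎ (β ≡ ε i ⊕ ε j))))
  ⊎ (∃[ i ] (β ≡ ε i))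

-- ℘(ξ) > 0 : ξ is a nonnegative integral combination of positive roots,
-- i.e. ξ is the sum of some finite list (multiset) of positive roots.
KostantPos : ∀ {r} → V r → Set
KostantPos ξ = ∃[ L ] (All IsPosRoot L × vsum L ≡ ξ)

-- Fundamental weight ϖ_k (1-based k, 1 ≤ k ≤ r):
-- ϖ_k = ε_1 + ⋯ + ε_k (k < r), ϖ_r = ½(ε_1 + ⋯ + ε_r).
ϖ : (r : ℕ) → ℕ → V r
ϖ r k = tabulate λ j →
  if k ≡ᵇ r then ½ else (if toℕ j <ᵇ k then 1ℚ else 0ℚ)

ρsum : (r : ℕ) → ℕ → V r
ρsum r zero = 𝟘
ρsum r (suc k) = ϖ r (suc k) ⊕ ρsum r k

ρ : (r : ℕ) → V r
ρ r = ρsum r r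

InA : (r : ℕ) → V r → V r → Word r → Set
InA r λ' μ σ = KostantPos (act r σ (λ' ⊕ ρ r) ⊖ (μ ⊕ ρ r))

-- |𝒜(λ,μ)| = N : there is a list of N pairwise distinct elements of W, all in
-- 𝒜(λ,μ), such that every element of 𝒜(λ,μ) equals one of them.
CardA : (r : ℕ) → V r → V r → ℕ → Set
CardA r λ' μ N = ∃[ L ]
  ( length L ≡ N
  × All (InA r λ' μ) L
  × AllPairs (λ w w' → ¬ (w ≈W w')) L
  × (∀ σ → InA r λ' μ σ → ∃[ τ ] (τ ∈ L × σ ≈W τ)))

fib : ℕ → ℕ
fib zero = zero
fib (suc zero) = suc zero
fib (suc (suc n)) = fib (suc n) ℕ.+ fib n

-- The Weyl group of B_r acts on ℚ^r by signed permutations, so σ(λ+ρ) − (μ+ρ) is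
-- integral, and an integral vector is a ℕ-combination of positive roots iff all its
-- prefix sums are nonnegative (every positive root has nonnegative prefix sums, and
-- conversely ξ = Σ_t (ξ₁ + ⋯ + ξ_t) α_t). For λ = ℓϖ₁ these inequalities say that the
-- first t coordinates of σ(λ+ρ) fall short of those of λ+ρ by at most the slack
-- Σ_{i≤t} (λ−μ)_i, which is 1 for t ≥ 3. This forces σ to fix ε₁, to act on ε₂, ε₃, ε₄
-- as 1, s₂ or s₂s₃, and on the remaining coordinates to be a product of commuting
-- adjacent transpositions s_i s_{i+2} ⋯, possibly ending with the sign change s_r.
-- There are F_{m+2} such products on m coordinates, giving F_r + F_{r−1} + F_{r−2} = 2F_r
-- elements, and they are pairwise distinct since they move (1, 2, …, r) to distinct points.
module Submission where

open import Data.Nat using (ℕ; zero; suc; z≤n; s≤s; _≡ᵇ_; _<ᵇ_)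
import Data.Nat as Nat
import Data.Nat.Properties as ℕP
import Data.Nat.DivMod as DivModP
open import Data.Integer as ℤ using (ℤ)
import Data.Integer.Properties as ℤP
open import Data.Rational using (ℚ; 0ℚ; 1ℚ; ½; toℚᵘ; fromℚᵘ)
import Data.Rational as Rat
import Data.Rational.Properties as ℚP
import Data.Rational.Unnormalised as ℚᵘ
import Data.Rational.Unnormalised.Properties as ℚᵘP
open import Data.Rational.Solver renaming (module +-*-Solver to ℚ-Solver)
open import Data.Nat.Solver renaming (module +-*-Solver to ℕ-Solver)
open import Data.Fin using (Fin; toℕ; fromℕ<)
import Data.Fin.Properties as FinP
open import Data.Vec using (Vec; []; _∷_; tabulate; zipWith)
import Data.Vec as Vec
open import Data.List using (List; []; _∷_; _++_; map; length)
import Data.List as List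
import Data.List.Properties as ListP
open import Data.List.Relation.Unary.All using (All; []; _∷_)
import Data.List.Relation.Unary.All as All
import Data.List.Relation.Unary.All.Properties as AllP
open import Data.List.Relation.Unary.AllPairs using (AllPairs; []; _∷_)
import Data.List.Relation.Unary.AllPairs as AllPairs
import Data.List.Relation.Unary.AllPairs.Properties as AllPairsP
open import Data.List.Relation.Unary.Any using (here; there)
open import Data.List.Membership.Propositional using (_∈_)
open import Data.List.Membership.Propositional.Properties using (∈-map⁺; ∈-map⁻; ∈-++⁺ˡ; ∈-++⁺ʳ; ∈-++⁻)
open import Data.Bool using (Bool; true; false; if_then_else_; T; not)
open import Data.Unit using (tt)
open import Data.Product using (_×_; _,_; proj₁; proj₂; ∃-syntax)
import Data.Product
open import Data.Sum using (_⊎_; inj₁; inj₂)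
import Data.Sum
open import Data.Empty using (⊥-elim)
open import Relation.Nullary using (¬_; yes; no)
open import Relation.Nullary.Decidable using (toWitness)
open import Relation.Binary.Definitions using (tri<; tri≈; tri>)
open import Relation.Binary.PropositionalEquality
open import Defs

module BooleanComparisons where

  open Nat using (_<_; _≤_)

  ≡ᵇ-refl : ∀ m → (m ≡ᵇ m) ≡ true
  ≡ᵇ-refl zero = refl
  ≡ᵇ-refl (suc m) = ≡ᵇ-refl m

  ≡ᵇ-true⇒≡ : ∀ {m n} → (m ≡ᵇ n) ≡ true → m ≡ n
  ≡ᵇ-true⇒≡ {m} {n} e = ℕP.≡ᵇ⇒≡ m n (subst T (sym e) tt)

  ≡ᵇ-false⇒≢ : ∀ {m n} → (m ≡ᵇ n) ≡ false → m ≢ n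
  ≡ᵇ-false⇒≢ {m} e refl = subst T (trans (sym (≡ᵇ-refl m)) e) tt

  ≢⇒≡ᵇ-false : ∀ {m n} → m ≢ n → (m ≡ᵇ n) ≡ false
  ≢⇒≡ᵇ-false {m} {n} m≢n with m ≡ᵇ n in e
  ... | true = ⊥-elim (m≢n (≡ᵇ-true⇒≡ e))
  ... | false = refl

  <⇒<ᵇ-true : ∀ {m n} → m < n → (m <ᵇ n) ≡ true
  <⇒<ᵇ-true {m} {n} m<n with m <ᵇ n | ℕP.<⇒<ᵇ m<n
  ... | true | _ = refl

  ≥⇒<ᵇ-false : ∀ {m n} → n ≤ m → (m <ᵇ n) ≡ false
  ≥⇒<ᵇ-false {m} {n} n≤m with m <ᵇ n in e
  ... | true = ⊥-elim (ℕP.<⇒≱ (ℕP.<ᵇ⇒< m n (subst T (sym e) tt)) n≤m)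
  ... | false = refl

open BooleanComparisons

module IntegersAsRationals where

  open Rat using (_+_; _-_; -_; _≤_)

  ℤtoℚ : ℤ → ℚ
  ℤtoℚ z = fromℚᵘ (ℚᵘ.mkℚᵘ z 0)

  toℚᵘ-ℤtoℚ : ∀ z → toℚᵘ (ℤtoℚ z) ℚᵘ.≃ ℚᵘ.mkℚᵘ z 0
  toℚᵘ-ℤtoℚ z = ℚP.toℚᵘ-fromℚᵘ (ℚᵘ.mkℚᵘ z 0)

  ℤtoℚ-+ : ∀ a b → ℤtoℚ (a ℤ.+ b) ≡ ℤtoℚ a + ℤtoℚ b
  ℤtoℚ-+ a b = ℚP.toℚᵘ-injective (begin
     toℚᵘ (ℤtoℚ (a ℤ.+ b))                    ≈⟨ toℚᵘ-ℤtoℚ (a ℤ.+ b) ⟩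
     ℚᵘ.mkℚᵘ (a ℤ.+ b) 0                      ≈⟨ ℚᵘ.*≡* denominators-one ⟩
     ℚᵘ.mkℚᵘ a 0 ℚᵘ.+ ℚᵘ.mkℚᵘ b 0              ≈⟨ ℚᵘP.+-cong (ℚᵘP.≃-sym (toℚᵘ-ℤtoℚ a)) (ℚᵘP.≃-sym (toℚᵘ-ℤtoℚ b)) ⟩
     toℚᵘ (ℤtoℚ a) ℚᵘ.+ toℚᵘ (ℤtoℚ b)          ≈⟨ ℚᵘP.≃-sym (ℚP.toℚᵘ-homo-+ (ℤtoℚ a) (ℤtoℚ b)) ⟩
     toℚᵘ (ℤtoℚ a + ℤtoℚ b)                   ∎)
    where
    open ℚᵘP.≃-Reasoning
    denominators-one : (a ℤ.+ b) ℤ.* ℤ.+ 1 ≡ (a ℤ.* ℤ.+ 1 ℤ.+ b ℤ.* ℤ.+ 1) ℤ.* ℤ.+ 1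
    denominators-one rewrite ℤP.*-identityʳ (a ℤ.+ b) | ℤP.*-identityʳ a | ℤP.*-identityʳ b
                           | ℤP.*-identityʳ (a ℤ.+ b) = refl

  ℕtoℚ-+ : ∀ m n → ℕtoℚ (m Nat.+ n) ≡ ℕtoℚ m + ℕtoℚ n
  ℕtoℚ-+ m n = ℤtoℚ-+ (ℤ.+ m) (ℤ.+ n)

  ℤtoℚ-neg : ∀ a → ℤtoℚ (ℤ.- a) ≡ - ℤtoℚ a
  ℤtoℚ-neg a = ℚP.toℚᵘ-injective (begin
     toℚᵘ (ℤtoℚ (ℤ.- a))   ≈⟨ toℚᵘ-ℤtoℚ (ℤ.- a) ⟩
     ℚᵘ.- ℚᵘ.mkℚᵘ a 0      ≈⟨ ℚᵘP.-‿cong (ℚᵘP.≃-sym (toℚᵘ-ℤtoℚ a)) ⟩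
     ℚᵘ.- toℚᵘ (ℤtoℚ a)    ≈⟨ ℚᵘP.≃-sym (ℚP.toℚᵘ-homo‿- (ℤtoℚ a)) ⟩
     toℚᵘ (- ℤtoℚ a)       ∎)
    where open ℚᵘP.≃-Reasoning

  ℤtoℚ-cancel-≤ : ∀ {a b} → ℤtoℚ a ≤ ℤtoℚ b → a ℤ.≤ b
  ℤtoℚ-cancel-≤ {a} {b} h = subst₂ ℤ._≤_ (ℤP.*-identityʳ a) (ℤP.*-identityʳ b)
    (ℚᵘP.drop-*≤* (ℚᵘP.≤-respʳ-≃ (toℚᵘ-ℤtoℚ b) (ℚᵘP.≤-respˡ-≃ (toℚᵘ-ℤtoℚ a) (ℚP.toℚᵘ-mono-≤ h))))

  ℤtoℚ-injective : ∀ {a b} → ℤtoℚ a ≡ ℤtoℚ b → a ≡ b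
  ℤtoℚ-injective h = ℤP.≤-antisym (ℤtoℚ-cancel-≤ (ℚP.≤-reflexive h)) (ℤtoℚ-cancel-≤ (ℚP.≤-reflexive (sym h)))

  ℕtoℚ-∸ : ∀ m n → n Nat.≤ m → ℕtoℚ m - ℕtoℚ n ≡ ℕtoℚ (m Nat.∸ n)
  ℕtoℚ-∸ m n n≤m = begin
    ℕtoℚ m - ℕtoℚ n                        ≡⟨ cong (λ k → ℕtoℚ k - ℕtoℚ n) (sym (ℕP.m∸n+n≡m n≤m)) ⟩
    ℕtoℚ ((m Nat.∸ n) Nat.+ n) - ℕtoℚ n    ≡⟨ cong (_- ℕtoℚ n) (ℕtoℚ-+ (m Nat.∸ n) n) ⟩
    (ℕtoℚ (m Nat.∸ n) + ℕtoℚ n) - ℕtoℚ n   ≡⟨ solve 2 (λ a b → (a :+ b) :- b := a) refl (ℕtoℚ (m Nat.∸ n)) (ℕtoℚ n) ⟩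
    ℕtoℚ (m Nat.∸ n)                       ∎
    where
    open ≡-Reasoning
    open ℚ-Solver

  ℕtoℚ-∸-nonneg : ∀ m n → 0ℚ ≤ ℕtoℚ m - ℕtoℚ n → n Nat.≤ m
  ℕtoℚ-∸-nonneg m n h = ℤP.drop‿+≤+ (ℤtoℚ-cancel-≤ {ℤ.+ n} {ℤ.+ m} (subst₂ _≤_ (ℚP.+-identityˡ (ℕtoℚ n))
    (solve 2 (λ a b → (a :- b) :+ b := a) refl (ℕtoℚ m) (ℕtoℚ n)) (ℚP.+-monoˡ-≤ (ℕtoℚ n) h)))
    where open ℚ-Solver

open IntegersAsRationals

-- Vectors are read through coord, which indexes by ℕ and is 0 outside the
-- range; this avoids converting between ℕ and Fin r in the arithmetic below.
module Coordinates where

  open Nat using (_<_; _≤_)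
  open Rat using (_+_; _-_; _*_; -_)

  coord : ∀ {n} → Vec ℚ n → ℕ → ℚ
  coord [] _ = 0ℚ
  coord (x ∷ xs) zero = x
  coord (x ∷ xs) (suc m) = coord xs m

  coord-≥ : ∀ {n} (v : Vec ℚ n) m → n ≤ m → coord v m ≡ 0ℚ
  coord-≥ [] m h = refl
  coord-≥ (x ∷ v) (suc m) (s≤s h) = coord-≥ v m h

  coord-ext : ∀ {n} (u v : Vec ℚ n) → (∀ m → m < n → coord u m ≡ coord v m) → u ≡ v
  coord-ext [] [] h = refl
  coord-ext (x ∷ u) (y ∷ v) h = cong₂ _∷_ (h 0 (s≤s z≤n)) (coord-ext u v (λ m p → h (suc m) (s≤s p)))

  coord-tabulate : ∀ {n} (g : ℕ → ℚ) m → m < n → coord (tabulate {n = n} (λ j → g (toℕ j))) m ≡ g m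
  coord-tabulate {suc n} g zero p = refl
  coord-tabulate {suc n} g (suc m) (s≤s p) = coord-tabulate {n} (λ k → g (suc k)) m p

  coord-map : ∀ {n} f (v : Vec ℚ n) m → m < n → coord (Vec.map f v) m ≡ f (coord v m)
  coord-map f (x ∷ v) zero p = refl
  coord-map f (x ∷ v) (suc m) (s≤s p) = coord-map f v m p

  coord-zipWith : ∀ {n} f (u v : Vec ℚ n) m → f 0ℚ 0ℚ ≡ 0ℚ → coord (zipWith f u v) m ≡ f (coord u m) (coord v m)
  coord-zipWith f [] [] m f00 = sym f00
  coord-zipWith f (x ∷ u) (y ∷ v) zero f00 = refl
  coord-zipWith f (x ∷ u) (y ∷ v) (suc m) f00 = coord-zipWith f u v m f00

  coord-⊕ : ∀ {n} (u v : V n) m → coord (u ⊕ v) m ≡ coord u m + coord v m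
  coord-⊕ u v m = coord-zipWith _+_ u v m refl

  coord-⊖ : ∀ {n} (u v : V n) m → coord (u ⊖ v) m ≡ coord u m - coord v m
  coord-⊖ u v m = coord-zipWith _-_ u v m refl

  coord-𝟘 : ∀ {n} m → coord (𝟘 {n}) m ≡ 0ℚ
  coord-𝟘 {zero} m = refl
  coord-𝟘 {suc n} zero = refl
  coord-𝟘 {suc n} (suc m) = coord-𝟘 {n} m

  pairWith : ∀ {n} → Vec ℚ n → (ℕ → ℚ) → ℚ
  pairWith [] g = 0ℚ
  pairWith (x ∷ xs) g = x * g 0 + pairWith xs (λ m → g (suc m))

  ⟨⟩-tabulate : ∀ {n} (v : Vec ℚ n) g → ⟨ v , tabulate (λ j → g (toℕ j)) ⟩ ≡ pairWith v g
  ⟨⟩-tabulate [] g = refl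
  ⟨⟩-tabulate (x ∷ v) g = cong (λ z → x * g 0 + z) (⟨⟩-tabulate v (λ m → g (suc m)))

  ⟨⟩-·-tabulate : ∀ {n} (v : Vec ℚ n) c g → ⟨ v , c · tabulate (λ j → g (toℕ j)) ⟩ ≡ pairWith v (λ m → c * g m)
  ⟨⟩-·-tabulate [] c g = refl
  ⟨⟩-·-tabulate (x ∷ v) c g = cong (λ z → x * (c * g 0) + z) (⟨⟩-·-tabulate v c (λ m → g (suc m)))

  pairWith-zero : ∀ {n} (v : Vec ℚ n) → pairWith v (λ _ → 0ℚ) ≡ 0ℚ
  pairWith-zero [] = refl
  pairWith-zero (x ∷ v) rewrite pairWith-zero v | ℚP.*-zeroʳ x = refl

  pairWith-point : ∀ {n} (v : Vec ℚ n) a c → pairWith v (λ m → if m ≡ᵇ a then c else 0ℚ) ≡ coord v a * c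
  pairWith-point [] a c = sym (ℚP.*-zeroˡ c)
  pairWith-point (x ∷ v) zero c rewrite pairWith-zero v = ℚP.+-identityʳ (x * c)
  pairWith-point (x ∷ v) (suc a) c rewrite pairWith-point v a c | ℚP.*-zeroʳ x = ℚP.+-identityˡ _

  pairWith-scaledPoint : ∀ {n} (v : Vec ℚ n) a c → pairWith v (λ m → c * (if m ≡ᵇ a then 1ℚ else 0ℚ)) ≡ c * coord v a
  pairWith-scaledPoint [] a c = sym (ℚP.*-zeroʳ c)
  pairWith-scaledPoint (x ∷ v) zero c
    rewrite ℚP.*-zeroʳ c | pairWith-zero v | ℚP.*-identityʳ c | ℚP.+-identityʳ (x * c) = ℚP.*-comm x c
  pairWith-scaledPoint (x ∷ v) (suc a) c rewrite pairWith-scaledPoint v a c | ℚP.*-zeroʳ c | ℚP.*-zeroʳ x = ℚP.+-identityˡ _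

  open ℚ-Solver

  pairWith-difference : ∀ {n} (v : Vec ℚ n) a →
    pairWith v (λ m → if m ≡ᵇ a then 1ℚ else (if m ≡ᵇ suc a then - 1ℚ else 0ℚ)) ≡ coord v a - coord v (suc a)
  pairWith-difference [] a = refl
  pairWith-difference (x ∷ v) zero rewrite pairWith-point v 0 (- 1ℚ) =
    solve 2 (λ x y → x :* con 1ℚ :+ y :* con (- 1ℚ) := x :- y) refl x (coord v 0)
  pairWith-difference (x ∷ v) (suc a) rewrite pairWith-difference v a | ℚP.*-zeroʳ x = ℚP.+-identityˡ _

open Coordinates

-- The simple reflection s_{a+1} permutes coordinates: it swaps a and a+1 when
-- a+1 < r and changes the sign of coordinate a when a+1 = r.
module SimpleReflections where

  open Nat using (_<_; _≤_)
  open Rat using (_+_; _-_; _*_; -_)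
  open ℚ-Solver

  swapAdj : ℕ → ℕ → ℕ
  swapAdj a j = if j ≡ᵇ a then suc a else (if j ≡ᵇ suc a then a else j)

  reflect : {A : Set} → (A → A) → ℕ → ℕ → (ℕ → A) → ℕ → A
  reflect negate r a f j = if suc a ≡ᵇ r then (if j ≡ᵇ a then negate (f j) else f j) else f (swapAdj a j)

  simpleRootCoord : Bool → ℕ → ℕ → ℚ
  simpleRootCoord isLast a m =
    if isLast then (if m ≡ᵇ a then 1ℚ else 0ℚ)
    else (if m ≡ᵇ a then 1ℚ else (if m ≡ᵇ suc a then - 1ℚ else 0ℚ))

  ⟨⟩-coroot : ∀ {n} (v : Vec ℚ n) (isLast : Bool) a →
    ⟨ v , (if isLast then (ℕtoℚ 2 · tabulate (λ j → simpleRootCoord isLast a (toℕ j)))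
                     else tabulate (λ j → simpleRootCoord isLast a (toℕ j))) ⟩
    ≡ (if isLast then ℕtoℚ 2 * coord v a else coord v a - coord v (suc a))
  ⟨⟩-coroot v true a = trans (⟨⟩-·-tabulate v (ℕtoℚ 2) (simpleRootCoord true a)) (pairWith-scaledPoint v a (ℕtoℚ 2))
  ⟨⟩-coroot v false a = trans (⟨⟩-tabulate v (simpleRootCoord false a)) (pairWith-difference v a)

  reflection-coord : (isLast : Bool) (a m : ℕ) (F : ℕ → ℚ) →
    F m - (if isLast then ℕtoℚ 2 * F a else F a - F (suc a)) * simpleRootCoord isLast a m
    ≡ (if isLast then (if m ≡ᵇ a then - (F m) else F m) else F (swapAdj a m))
  reflection-coord true a m F with m ≡ᵇ a in e
  ... | true rewrite ≡ᵇ-true⇒≡ {m} {a} e = solve 1 (λ x → x :- con (ℕtoℚ 2) :* x :* con 1ℚ := :- x) refl (F a)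
  ... | false = solve 2 (λ x y → x :- y :* con 0ℚ := x) refl (F m) (ℕtoℚ 2 * F a)
  reflection-coord false a m F with m ≡ᵇ a in e
  ... | true rewrite ≡ᵇ-true⇒≡ {m} {a} e = solve 2 (λ x y → x :- (x :- y) :* con 1ℚ := y) refl (F a) (F (suc a))
  ... | false with m ≡ᵇ suc a in e′
  ... | true rewrite ≡ᵇ-true⇒≡ {m} {suc a} e′ = solve 2 (λ x y → y :- (x :- y) :* con (- 1ℚ) := x) refl (F a) (F (suc a))
  ... | false = solve 2 (λ x y → x :- y :* con 0ℚ := x) refl (F m) (F a - F (suc a))

  coord-s : ∀ r (i : Fin r) (v : V r) m → m < r → coord (s r i v) m ≡ reflect -_ r (toℕ i) (coord v) m
  coord-s r i v m m<r = begin
    coord (s r i v) m                                  ≡⟨ coord-⊖ v _ m ⟩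
    coord v m - coord (c · simpleRoot r i) m           ≡⟨ cong (λ z → coord v m - z) (coord-map (c *_) (simpleRoot r i) m m<r) ⟩
    coord v m - c * coord (simpleRoot r i) m           ≡⟨ cong (λ z → coord v m - c * z) (coord-tabulate (simpleRootCoord isLast a) m m<r) ⟩
    coord v m - c * simpleRootCoord isLast a m         ≡⟨ cong (λ z → coord v m - z * simpleRootCoord isLast a m) (⟨⟩-coroot v isLast a) ⟩
    coord v m - (if isLast then ℕtoℚ 2 * coord v a else coord v a - coord v (suc a)) * simpleRootCoord isLast a m
                                                       ≡⟨ reflection-coord isLast a m (coord v) ⟩
    reflect -_ r a (coord v) m                         ∎
    where
    open ≡-Reasoning
    a : ℕ
    a = toℕ i
    isLast : Bool
    isLast = suc a ≡ᵇ r
    c : ℚ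
    c = ⟨ v , simpleCoroot r i ⟩

open SimpleReflections

module SwapAdjProperties where

  open Nat using (_<_; _≤_)

  swapAdj-below : ∀ a i → i < a → swapAdj a i ≡ i
  swapAdj-below a i i<a rewrite ≢⇒≡ᵇ-false {i} {a} (ℕP.<⇒≢ i<a) | ≢⇒≡ᵇ-false {i} {suc a} (ℕP.<⇒≢ (ℕP.m<n⇒m<1+n i<a)) = refl

  swapAdj-above : ∀ a i → suc a < i → swapAdj a i ≡ i
  swapAdj-above a i a+1<i rewrite ≢⇒≡ᵇ-false {i} {a} (ℕP.>⇒≢ (ℕP.<-trans (ℕP.n<1+n a) a+1<i))
                           | ≢⇒≡ᵇ-false {i} {suc a} (ℕP.>⇒≢ a+1<i) = refl

  swapAdj-left : ∀ a → swapAdj a a ≡ suc a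
  swapAdj-left a rewrite ≡ᵇ-refl a = refl

  swapAdj-right : ∀ a → swapAdj a (suc a) ≡ a
  swapAdj-right a rewrite ≢⇒≡ᵇ-false {suc a} {a} ℕP.1+n≢n | ≡ᵇ-refl a = refl

  swapAdj-involutive : ∀ a m → swapAdj a (swapAdj a m) ≡ m
  swapAdj-involutive a m with m ≡ᵇ a in e
  ... | true rewrite ≡ᵇ-true⇒≡ {m} {a} e = swapAdj-right a
  ... | false with m ≡ᵇ suc a in e′
  ... | true rewrite ≡ᵇ-true⇒≡ {m} {suc a} e′ = swapAdj-left a
  ... | false rewrite e | e′ = refl

  swapAdj-< : ∀ {n} a m → suc a < n → m < n → swapAdj a m < n
  swapAdj-< a m a+1<n m<n with m ≡ᵇ a
  ... | true = a+1<n
  ... | false with m ≡ᵇ suc a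
  ... | true = ℕP.<-trans (ℕP.n<1+n a) a+1<n
  ... | false = m<n

open SwapAdjProperties

-- (true , p) stands for +ε_p and (false , p) for −ε_p.
SignedIndex : Set
SignedIndex = Bool × ℕ

index : SignedIndex → ℕ
index = proj₂

flipSign : SignedIndex → SignedIndex
flipSign (b , p) = (not b , p)

module SignedPermutations where

  open Nat using (_<_; _≤_)
  open Rat using (-_)

  signedCoord : ∀ {r} → V r → SignedIndex → ℚ
  signedCoord v (b , p) = if b then coord v p else - coord v p

  signedCoord-flip : ∀ {r} (v : V r) x → signedCoord v (flipSign x) ≡ - signedCoord v x
  signedCoord-flip v (true , p) = refl
  signedCoord-flip v (false , p) = solve 1 (λ x → x := :- (:- x)) refl (coord v p)
    where open ℚ-Solver

  -- Coordinate m of w·v is ±v_p where (±, p) = signedPerm r w m; words are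
  -- lists of 0-based letters, a standing for s_{a+1}.
  signedPerm : ℕ → List ℕ → ℕ → SignedIndex
  signedPerm r [] m = (true , m)
  signedPerm r (a ∷ τ) = reflect flipSign r a (signedPerm r τ)

  reflect-notLast : ∀ {A : Set} (negate : A → A) r a f j → suc a < r → reflect negate r a f j ≡ f (swapAdj a j)
  reflect-notLast negate r a f j a+1<r rewrite ≢⇒≡ᵇ-false {suc a} {r} (ℕP.<⇒≢ a+1<r) = refl

  reflect-signedCoord : ∀ {r} (v : V r) a (F : ℕ → ℚ) (G : ℕ → SignedIndex) → a < r →
    (∀ n → n < r → F n ≡ signedCoord v (G n)) → ∀ m → m < r →
    reflect -_ r a F m ≡ signedCoord v (reflect flipSign r a G m)
  reflect-signedCoord {r} v a F G a<r F≡G m m<r with suc a ≡ᵇ r in e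
  ... | true with m ≡ᵇ a
  ... | true = trans (cong -_ (F≡G m m<r)) (sym (signedCoord-flip v (G m)))
  ... | false = F≡G m m<r
  reflect-signedCoord {r} v a F G a<r F≡G m m<r | false =
    F≡G (swapAdj a m) (swapAdj-< a m (ℕP.≤∧≢⇒< a<r (≡ᵇ-false⇒≢ e)) m<r)

  coord-act : ∀ r (w : Word r) (v : V r) m → m < r → coord (act r w v) m ≡ signedCoord v (signedPerm r (map toℕ w) m)
  coord-act r [] v m m<r = refl
  coord-act r (i ∷ w) v m m<r =
    trans (coord-s r i (act r w v) m m<r)
          (reflect-signedCoord v (toℕ i) (coord (act r w v)) (signedPerm r (map toℕ w)) (FinP.toℕ<n i)
                               (λ n n<r → coord-act r w v n n<r) m m<r)

  signedPerm⇒≈W : ∀ r (w w′ : Word r) → (∀ m → m < r → signedPerm r (map toℕ w) m ≡ signedPerm r (map toℕ w′) m) → w ≈W w′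
  signedPerm⇒≈W r w w′ same v = coord-ext _ _ λ m m<r →
    trans (coord-act r w v m m<r) (trans (cong (signedCoord v) (same m m<r)) (sym (coord-act r w′ v m m<r)))

  -- The underlying permutation of signedPerm r τ is a composite of involutions.
  indexMap : ℕ → ℕ → ℕ → ℕ
  indexMap r a j = if suc a ≡ᵇ r then j else swapAdj a j

  index-reflect : ∀ r a f j → index (reflect flipSign r a f j) ≡ index (f (indexMap r a j))
  index-reflect r a f j with suc a ≡ᵇ r
  ... | true with j ≡ᵇ a
  ... | true = refl
  ... | false = refl
  index-reflect r a f j | false = refl

  indexMap-involutive : ∀ r a j → indexMap r a (indexMap r a j) ≡ j
  indexMap-involutive r a j with suc a ≡ᵇ r
  ... | true = refl
  ... | false = swapAdj-involutive a j

  indexMap-< : ∀ {r} a j → a < r → j < r → indexMap r a j < r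
  indexMap-< {r} a j a<r j<r with suc a ≡ᵇ r in e
  ... | true = j<r
  ... | false = swapAdj-< a j (ℕP.≤∧≢⇒< a<r (≡ᵇ-false⇒≢ e)) j<r

  signedPerm-index-< : ∀ {r} τ → All (_< r) τ → ∀ j → j < r → index (signedPerm r τ j) < r
  signedPerm-index-< [] [] j j<r = j<r
  signedPerm-index-< {r} (a ∷ τ) (a<r ∷ τ<r) j j<r = subst (_< r) (sym (index-reflect r a (signedPerm r τ) j))
    (signedPerm-index-< τ τ<r (indexMap r a j) (indexMap-< a j a<r j<r))

  signedPerm-index-injective : ∀ r τ i j → index (signedPerm r τ i) ≡ index (signedPerm r τ j) → i ≡ j
  signedPerm-index-injective r [] i j e = e
  signedPerm-index-injective r (a ∷ τ) i j e = begin
    i                                ≡⟨ sym (indexMap-involutive r a i) ⟩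
    indexMap r a (indexMap r a i)    ≡⟨ cong (indexMap r a) (signedPerm-index-injective r τ _ _ e′) ⟩
    indexMap r a (indexMap r a j)    ≡⟨ indexMap-involutive r a j ⟩
    j                                ∎
    where
    open ≡-Reasoning
    e′ : index (signedPerm r τ (indexMap r a i)) ≡ index (signedPerm r τ (indexMap r a j))
    e′ = trans (sym (index-reflect r a (signedPerm r τ) i)) (trans e (index-reflect r a (signedPerm r τ) j))

open SignedPermutations

module PrefixSumCriterion where

  open Nat using (_<_; _≤_; _<?_)
  open Rat using (_+_; _-_; _*_; -_) renaming (_≤_ to _≤ℚ_)
  open ℚ-Solver

  indicator : Bool → ℚ
  indicator b = if b then 1ℚ else 0ℚ

  0≤indicator : ∀ b → 0ℚ ≤ℚ indicator b
  0≤indicator true = toWitness {a? = 0ℚ ℚP.≤? 1ℚ} tt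
  0≤indicator false = ℚP.≤-refl

  prefixSum : ∀ {r} → ℕ → V r → ℚ
  prefixSum zero v = 0ℚ
  prefixSum (suc t) v = prefixSum t v + coord v t

  prefixSum-⊕ : ∀ {r} t (u w : V r) → prefixSum t (u ⊕ w) ≡ prefixSum t u + prefixSum t w
  prefixSum-⊕ zero u w = refl
  prefixSum-⊕ (suc t) u w rewrite prefixSum-⊕ t u w | coord-⊕ u w t =
    solve 4 (λ a b c d → (a :+ b) :+ (c :+ d) := (a :+ c) :+ (b :+ d)) refl (prefixSum t u) (prefixSum t w) (coord u t) (coord w t)

  prefixSum-⊖ : ∀ {r} t (u w : V r) → prefixSum t (u ⊖ w) ≡ prefixSum t u - prefixSum t w
  prefixSum-⊖ zero u w = refl
  prefixSum-⊖ (suc t) u w rewrite prefixSum-⊖ t u w | coord-⊖ u w t =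
    solve 4 (λ a b c d → (a :- b) :+ (c :- d) := (a :+ c) :- (b :+ d)) refl (prefixSum t u) (prefixSum t w) (coord u t) (coord w t)

  prefixSum-𝟘 : ∀ {r} t → prefixSum t (𝟘 {r}) ≡ 0ℚ
  prefixSum-𝟘 zero = refl
  prefixSum-𝟘 {r} (suc t) rewrite prefixSum-𝟘 {r} t | coord-𝟘 {r} t = refl

  coord-ε : ∀ {r} (i : Fin r) m → coord (ε i) m ≡ indicator (m ≡ᵇ toℕ i)
  coord-ε {r} i m with m <? r
  ... | yes m<r = coord-tabulate (λ k → if k ≡ᵇ toℕ i then 1ℚ else 0ℚ) m m<r
  ... | no m≮r rewrite coord-≥ (ε i) m (ℕP.≮⇒≥ m≮r)
                     | ≢⇒≡ᵇ-false {m} {toℕ i} (λ e → m≮r (subst (_< r) (sym e) (FinP.toℕ<n i))) = refl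

  prefixSum-ε : ∀ {r} (i : Fin r) t → prefixSum t (ε i) ≡ indicator (toℕ i <ᵇ t)
  prefixSum-ε i zero = refl
  prefixSum-ε i (suc t) rewrite prefixSum-ε i t | coord-ε i t with ℕP.<-cmp (toℕ i) t
  ... | tri< i<t _ _ rewrite <⇒<ᵇ-true i<t | <⇒<ᵇ-true (ℕP.m<n⇒m<1+n i<t) | ≢⇒≡ᵇ-false {t} {toℕ i} (ℕP.>⇒≢ i<t) = refl
  ... | tri≈ _ refl _ rewrite ≥⇒<ᵇ-false (ℕP.≤-refl {t}) | ≡ᵇ-refl t | <⇒<ᵇ-true (ℕP.n<1+n t) = refl
  ... | tri> _ _ t<i rewrite ≥⇒<ᵇ-false (ℕP.<⇒≤ t<i) | ≥⇒<ᵇ-false t<i | ≢⇒≡ᵇ-false {t} {toℕ i} (ℕP.<⇒≢ t<i) = refl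

  prefixSum-posRoot : ∀ {r} (β : V r) → IsPosRoot β → ∀ t → 0ℚ ≤ℚ prefixSum t β
  prefixSum-posRoot β (inj₁ (i , j , i<j , inj₁ refl)) t
    rewrite prefixSum-⊖ t (ε i) (ε j) | prefixSum-ε i t | prefixSum-ε j t with toℕ j <? t
  ... | yes j<t rewrite <⇒<ᵇ-true j<t | <⇒<ᵇ-true (ℕP.<-trans i<j j<t) = ℚP.≤-refl
  ... | no j≮t rewrite ≥⇒<ᵇ-false {toℕ j} (ℕP.≮⇒≥ j≮t) =
    subst (0ℚ ≤ℚ_) (sym (ℚP.+-identityʳ (indicator (toℕ i <ᵇ t)))) (0≤indicator _)
  prefixSum-posRoot β (inj₁ (i , j , i<j , inj₂ refl)) t rewrite prefixSum-⊕ t (ε i) (ε j) | prefixSum-ε i t | prefixSum-ε j t =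
    ℚP.+-mono-≤ (0≤indicator (toℕ i <ᵇ t)) (0≤indicator (toℕ j <ᵇ t))
  prefixSum-posRoot β (inj₂ (i , refl)) t rewrite prefixSum-ε i t = 0≤indicator _

  prefixSum-vsum-posRoots : ∀ {r} (L : List (V r)) → All IsPosRoot L → ∀ t → 0ℚ ≤ℚ prefixSum t (vsum L)
  prefixSum-vsum-posRoots {r} [] [] t = ℚP.≤-reflexive (sym (prefixSum-𝟘 {r} t))
  prefixSum-vsum-posRoots (β ∷ L) (β⁺ ∷ L⁺) t rewrite prefixSum-⊕ t β (vsum L) =
    ℚP.+-mono-≤ (prefixSum-posRoot β β⁺ t) (prefixSum-vsum-posRoots L L⁺ t)

  KostantPos⇒prefixSum-nonneg : ∀ {r} (ξ : V r) → KostantPos ξ → ∀ t → 0ℚ ≤ℚ prefixSum t ξ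
  KostantPos⇒prefixSum-nonneg ξ (L , L⁺ , refl) = prefixSum-vsum-posRoots L L⁺

  -- α_{t+1} = ε_t − ε_{t+1}, which for t = r − 1 is truncated to α_r = ε_{r−1}.
  adjacentRoot : (r : ℕ) → ℕ → V r
  adjacentRoot r t = tabulate (λ j → simpleRootCoord false t (toℕ j))

  coord-adjacentRoot : ∀ r t m → m < r → coord (adjacentRoot r t) m ≡ simpleRootCoord false t m
  coord-adjacentRoot r t m m<r = coord-tabulate (simpleRootCoord false t) m m<r

  coord-ε-fromℕ< : ∀ {r t} (t<r : t < r) m → coord (ε (fromℕ< t<r)) m ≡ indicator (m ≡ᵇ t)
  coord-ε-fromℕ< t<r m = trans (coord-ε _ m) (cong (λ n → indicator (m ≡ᵇ n)) (FinP.toℕ-fromℕ< t<r))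

  simpleRootCoord-notLast : ∀ t m → indicator (m ≡ᵇ t) - indicator (m ≡ᵇ suc t) ≡ simpleRootCoord false t m
  simpleRootCoord-notLast t m with m ≡ᵇ t in e
  ... | true rewrite ≡ᵇ-true⇒≡ {m} {t} e | ≢⇒≡ᵇ-false {t} {suc t} (λ e → ℕP.1+n≢n (sym e)) = refl
  ... | false with m ≡ᵇ suc t
  ... | true = refl
  ... | false = refl

  simpleRootCoord-last : ∀ r t m → ¬ (suc t < r) → m < r → indicator (m ≡ᵇ t) ≡ simpleRootCoord false t m
  simpleRootCoord-last r t m t+1≮r m<r with m ≡ᵇ t
  ... | true = refl
  ... | false rewrite ≢⇒≡ᵇ-false {m} {suc t} (λ e → t+1≮r (subst (_< r) e m<r)) = refl

  adjacentRoot-isPosRoot : ∀ r t → t < r → IsPosRoot (adjacentRoot r t)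
  adjacentRoot-isPosRoot r t t<r with suc t <? r
  ... | yes t+1<r = inj₁ (fromℕ< t<r , fromℕ< t+1<r ,
        subst₂ _<_ (sym (FinP.toℕ-fromℕ< t<r)) (sym (FinP.toℕ-fromℕ< t+1<r)) (ℕP.n<1+n t) ,
        inj₁ (coord-ext _ _ λ m m<r → begin
          coord (adjacentRoot r t) m                                 ≡⟨ coord-adjacentRoot r t m m<r ⟩
          simpleRootCoord false t m                                  ≡⟨ sym (simpleRootCoord-notLast t m) ⟩
          indicator (m ≡ᵇ t) - indicator (m ≡ᵇ suc t)                ≡⟨ sym (cong₂ _-_ (coord-ε-fromℕ< t<r m) (coord-ε-fromℕ< t+1<r m)) ⟩
          coord (ε (fromℕ< t<r)) m - coord (ε (fromℕ< t+1<r)) m      ≡⟨ sym (coord-⊖ (ε (fromℕ< t<r)) _ m) ⟩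
          coord (ε (fromℕ< t<r) ⊖ ε (fromℕ< t+1<r)) m                ∎))
    where open ≡-Reasoning
  ... | no t+1≮r = inj₂ (fromℕ< t<r , coord-ext _ _ λ m m<r →
        trans (coord-adjacentRoot r t m m<r) (sym (trans (coord-ε-fromℕ< t<r m) (simpleRootCoord-last r t m t+1≮r m<r))))

  adjacentRootsWith : (r : ℕ) → (ℕ → ℕ) → ℕ → List (V r)
  adjacentRootsWith r c zero = []
  adjacentRootsWith r c (suc t) = List.replicate (c t) (adjacentRoot r t) ++ adjacentRootsWith r c t

  adjacentRootsWith-posRoots : ∀ r c t → t ≤ r → All IsPosRoot (adjacentRootsWith r c t)
  adjacentRootsWith-posRoots r c zero _ = []
  adjacentRootsWith-posRoots r c (suc t) t<r = AllP.++⁺ (AllP.replicate⁺ (c t) (adjacentRoot-isPosRoot r t t<r))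
    (adjacentRootsWith-posRoots r c t (ℕP.≤-trans (ℕP.n≤1+n t) t<r))

  coord-vsum-replicate : ∀ {r} k (β : V r) L m → coord (vsum (List.replicate k β ++ L)) m ≡ ℕtoℚ k * coord β m + coord (vsum L) m
  coord-vsum-replicate zero β L m = sym (trans (cong (_+ coord (vsum L) m) (ℚP.*-zeroˡ (coord β m))) (ℚP.+-identityˡ _))
  coord-vsum-replicate (suc k) β L m
    rewrite coord-⊕ β (vsum (List.replicate k β ++ L)) m | coord-vsum-replicate k β L m | ℕtoℚ-+ 1 k =
    solve 3 (λ x y z → x :+ (y :* x :+ z) := (con 1ℚ :+ y) :* x :+ z) refl (coord β m) (ℕtoℚ k) (coord (vsum L) m)

  -- Coordinate m of Σ_{s<t} e_s α_{s+1}.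
  telescope : (ℕ → ℚ) → ℕ → ℕ → ℚ
  telescope e t zero = indicator (0 <ᵇ t) * e 0
  telescope e t (suc m) = indicator (suc m <ᵇ t) * e (suc m) - indicator (m <ᵇ t) * e m

  indicator-< : ∀ {m t} → m < t → indicator (m <ᵇ t) ≡ 1ℚ
  indicator-< m<t = cong indicator (<⇒<ᵇ-true m<t)

  indicator-≥ : ∀ {m t} → t ≤ m → indicator (m <ᵇ t) ≡ 0ℚ
  indicator-≥ t≤m = cong indicator (≥⇒<ᵇ-false t≤m)

  simpleRootCoord-at : ∀ t → simpleRootCoord false t t ≡ 1ℚ
  simpleRootCoord-at t rewrite ≡ᵇ-refl t = refl

  simpleRootCoord-after : ∀ t → simpleRootCoord false t (suc t) ≡ - 1ℚ
  simpleRootCoord-after t rewrite ≢⇒≡ᵇ-false {suc t} {t} ℕP.1+n≢n | ≡ᵇ-refl t = refl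

  simpleRootCoord-away : ∀ t n → n ≢ t → n ≢ suc t → simpleRootCoord false t n ≡ 0ℚ
  simpleRootCoord-away t n n≢t n≢t+1 rewrite ≢⇒≡ᵇ-false n≢t | ≢⇒≡ᵇ-false n≢t+1 = refl

  -- telescope-step at a positive coordinate, once the five Boolean factors are evaluated.
  telescope-step-by : ∀ (e : ℕ → ℚ) t m G a₁ a₂ a₃ a₄ →
    simpleRootCoord false t (suc m) ≡ G →
    indicator (suc m <ᵇ t) ≡ a₁ → indicator (m <ᵇ t) ≡ a₂ →
    indicator (suc m <ᵇ suc t) ≡ a₃ → indicator (m <ᵇ suc t) ≡ a₄ →
    e t * G + (a₁ * e (suc m) - a₂ * e m) ≡ a₃ * e (suc m) - a₄ * e m →
    e t * simpleRootCoord false t (suc m) + telescope e t (suc m) ≡ telescope e (suc t) (suc m)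
  telescope-step-by e t m G a₁ a₂ a₃ a₄ g h₁ h₂ h₃ h₄ eq = begin
    e t * simpleRootCoord false t (suc m) + (indicator (suc m <ᵇ t) * e (suc m) - indicator (m <ᵇ t) * e m)
      ≡⟨ cong₂ (λ u v → e t * u + v) g (cong₂ (λ u v → u * e (suc m) - v * e m) h₁ h₂) ⟩
    e t * G + (a₁ * e (suc m) - a₂ * e m)
      ≡⟨ eq ⟩
    a₃ * e (suc m) - a₄ * e m
      ≡⟨ sym (cong₂ (λ u v → u * e (suc m) - v * e m) h₃ h₄) ⟩
    indicator (suc m <ᵇ suc t) * e (suc m) - indicator (m <ᵇ suc t) * e m ∎
    where open ≡-Reasoning

  telescope-step : ∀ (e : ℕ → ℚ) t m → e t * simpleRootCoord false t m + telescope e t m ≡ telescope e (suc t) m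
  telescope-step e zero zero = solve 1 (λ x → x :* con 1ℚ :+ con 0ℚ :* x := con 1ℚ :* x) refl (e 0)
  telescope-step e (suc t) zero = solve 2 (λ x y → y :* con 0ℚ :+ con 1ℚ :* x := con 1ℚ :* x) refl (e 0) (e (suc t))
  telescope-step e t (suc m) with ℕP.<-cmp m t
  ... | tri> _ _ t<m = telescope-step-by e t m 0ℚ 0ℚ 0ℚ 0ℚ 0ℚ
    (simpleRootCoord-away t (suc m) (ℕP.>⇒≢ (ℕP.m<n⇒m<1+n t<m)) (ℕP.>⇒≢ (s≤s t<m)))
    (indicator-≥ (ℕP.<⇒≤ (ℕP.m<n⇒m<1+n t<m))) (indicator-≥ (ℕP.<⇒≤ t<m)) (indicator-≥ (ℕP.<⇒≤ t<m)) (indicator-≥ t<m)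
    (solve 3 (λ x y z → z :* con 0ℚ :+ (con 0ℚ :* x :- con 0ℚ :* y) := con 0ℚ :* x :- con 0ℚ :* y) refl (e (suc m)) (e m) (e t))
  ... | tri≈ _ refl _ = telescope-step-by e m m (- 1ℚ) 0ℚ 0ℚ 0ℚ 1ℚ
    (simpleRootCoord-after m) (indicator-≥ {suc m} {m} (ℕP.n≤1+n m)) (indicator-≥ {m} {m} ℕP.≤-refl)
    (indicator-≥ {m} {m} ℕP.≤-refl) (indicator-< {m} {suc m} (ℕP.n<1+n m))
    (solve 2 (λ x y → y :* (:- con 1ℚ) :+ (con 0ℚ :* x :- con 0ℚ :* y) := con 0ℚ :* x :- con 1ℚ :* y) refl (e (suc m)) (e m))
  ... | tri< m<t _ _ with ℕP.<-cmp (suc m) t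
  ... | tri< m+1<t _ _ = telescope-step-by e t m 0ℚ 1ℚ 1ℚ 1ℚ 1ℚ
    (simpleRootCoord-away t (suc m) (ℕP.<⇒≢ m+1<t) (λ q → ℕP.<⇒≢ m<t (ℕP.suc-injective q)))
    (indicator-< m+1<t) (indicator-< m<t) (indicator-< m<t) (indicator-< (ℕP.m<n⇒m<1+n m<t))
    (solve 3 (λ x y z → z :* con 0ℚ :+ (con 1ℚ :* x :- con 1ℚ :* y) := con 1ℚ :* x :- con 1ℚ :* y) refl (e (suc m)) (e m) (e t))
  ... | tri≈ _ refl _ = telescope-step-by e (suc m) m 1ℚ 0ℚ 1ℚ 1ℚ 1ℚ
    (simpleRootCoord-at (suc m)) (indicator-≥ {suc m} {suc m} ℕP.≤-refl) (indicator-< {m} {suc m} m<t)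
    (indicator-< {m} {suc m} m<t) (indicator-< {m} {suc (suc m)} (ℕP.m<n⇒m<1+n m<t))
    (solve 2 (λ x y → x :* con 1ℚ :+ (con 0ℚ :* x :- con 1ℚ :* y) := con 1ℚ :* x :- con 1ℚ :* y) refl (e (suc m)) (e m))
  ... | tri> _ _ t<m+1 = ⊥-elim (ℕP.<-irrefl refl (ℕP.<-≤-trans t<m+1 m<t))

  coord-adjacentRootsWith : ∀ r c t m → m < r → coord (vsum (adjacentRootsWith r c t)) m ≡ telescope (λ s → ℕtoℚ (c s)) t m
  coord-adjacentRootsWith r c zero zero _ = trans (coord-𝟘 {r} 0) (sym (ℚP.*-zeroˡ (ℕtoℚ (c 0))))
  coord-adjacentRootsWith r c zero (suc m) _ = trans (coord-𝟘 {r} (suc m))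
    (sym (solve 2 (λ x y → con 0ℚ :* x :- con 0ℚ :* y := con 0ℚ) refl (ℕtoℚ (c (suc m))) (ℕtoℚ (c m))))
  coord-adjacentRootsWith r c (suc t) m m<r
    rewrite coord-vsum-replicate (c t) (adjacentRoot r t) (adjacentRootsWith r c t) m
          | coord-adjacentRoot r t m m<r | coord-adjacentRootsWith r c t m m<r =
    telescope-step (λ s → ℕtoℚ (c s)) t m

  -- ξ = Σ_t c_t α_{t+1} where c_t = ξ₀ + ⋯ + ξ_t.
  prefixSum-ℕ⇒KostantPos : ∀ {r} (ξ : V r) (c : ℕ → ℕ) → (∀ t → t < r → prefixSum (suc t) ξ ≡ ℕtoℚ (c t)) → KostantPos ξ
  prefixSum-ℕ⇒KostantPos {r} ξ c prefix≡c =
    adjacentRootsWith r c r , adjacentRootsWith-posRoots r c r ℕP.≤-refl ,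
    coord-ext _ _ λ m m<r → trans (coord-adjacentRootsWith r c r m m<r) (telescope-prefixSums m m<r)
    where
    telescope-prefixSums : ∀ m → m < r → telescope (λ s → ℕtoℚ (c s)) r m ≡ coord ξ m
    telescope-prefixSums zero m<r rewrite <⇒<ᵇ-true m<r | sym (prefix≡c 0 m<r) = trans (ℚP.*-identityˡ _) (ℚP.+-identityˡ _)
    telescope-prefixSums (suc m) m<r
      rewrite <⇒<ᵇ-true m<r | <⇒<ᵇ-true (ℕP.<-trans (ℕP.n<1+n m) m<r)
            | sym (prefix≡c (suc m) m<r) | sym (prefix≡c m (ℕP.<-trans (ℕP.n<1+n m) m<r)) =
      solve 2 (λ x y → con 1ℚ :* (x :+ y) :- con 1ℚ :* x := y) refl (prefixSum (suc m) ξ) (coord ξ (suc m))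

open PrefixSumCriterion

sumBelow : (ℕ → ℕ) → ℕ → ℕ
sumBelow g zero = 0
sumBelow g (suc s) = sumBelow g s Nat.+ g s

-- Signed permutations of rank R + 1 measured against λ + ρ for λ = ℓϖ₁.
module Deficits (R ℓ : ℕ) where

  open Nat using (_+_; _∸_; _≤_; _<_; _≤?_)
  open ℕ-Solver

  perm : List ℕ → ℕ → SignedIndex
  perm = signedPerm (suc R)

  perm-swap : ∀ a τ j → suc a ≤ R → perm (a ∷ τ) j ≡ perm τ (swapAdj a j)
  perm-swap a τ j a+1≤R = reflect-notLast flipSign (suc R) a (perm τ) j (s≤s a+1≤R)

  perm-below : ∀ τ t → All (t ≤_) τ → ∀ i → i < t → perm τ i ≡ (true , i)
  perm-below [] t _ i i<t = refl
  perm-below (a ∷ τ) t (t≤a ∷ t≤τ) i i<t with suc a ≡ᵇ suc R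
  ... | true rewrite ≢⇒≡ᵇ-false {i} {a} (ℕP.<⇒≢ (ℕP.<-≤-trans i<t t≤a)) = perm-below τ t t≤τ i i<t
  ... | false rewrite swapAdj-below a i (ℕP.<-≤-trans i<t t≤a) = perm-below τ t t≤τ i i<t

  -- (λ+ρ)_p = ν p + ½, so ±ε_p contributes ν p, resp. −(ν p + 1), to σ(λ+ρ) − ½(1, …, 1).
  ν : ℕ → ℕ
  ν zero = ℓ + R
  ν (suc p) = R ∸ suc p

  posPart : SignedIndex → ℕ
  posPart (true , p) = ν p
  posPart (false , p) = 0

  negPart : SignedIndex → ℕ
  negPart (true , p) = 0
  negPart (false , p) = suc (ν p)

  Σν : ℕ → ℕ
  Σν = sumBelow ν

  Σpos Σneg : (ℕ → SignedIndex) → ℕ → ℕ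
  Σpos π = sumBelow (λ i → posPart (π i))
  Σneg π = sumBelow (λ i → negPart (π i))

  -- The first t coordinates of π(λ+ρ) sum to d less than those of λ+ρ.
  Deficit : (ℕ → SignedIndex) → ℕ → ℕ → Set
  Deficit π t d = Σneg π t + Σν t ≡ Σpos π t + d

  DeficitAtMost : (ℕ → SignedIndex) → ℕ → ℕ → Set
  DeficitAtMost π t c = Σneg π t + Σν t ≤ Σpos π t + c

  deficit-next : ∀ π t {d} x d′ → π t ≡ x → Deficit π t d → d + (negPart x + ν t) ≡ posPart x + d′ → Deficit π (suc t) d′
  deficit-next π t {d} x d′ refl def step = begin
    (Σneg π t + negPart x) + (Σν t + ν t)
      ≡⟨ solve 4 (λ a b c e → (a :+ b) :+ (c :+ e) := (a :+ c) :+ (b :+ e)) refl (Σneg π t) (negPart x) (Σν t) (ν t) ⟩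
    (Σneg π t + Σν t) + (negPart x + ν t)  ≡⟨ cong (_+ (negPart x + ν t)) def ⟩
    (Σpos π t + d) + (negPart x + ν t)     ≡⟨ ℕP.+-assoc (Σpos π t) d _ ⟩
    Σpos π t + (d + (negPart x + ν t))     ≡⟨ cong (Σpos π t +_) step ⟩
    Σpos π t + (posPart x + d′)            ≡⟨ sym (ℕP.+-assoc (Σpos π t) _ d′) ⟩
    (Σpos π t + posPart x) + d′            ∎
    where open ≡-Reasoning

  deficit-next-≤ : ∀ π t {d c} x → π t ≡ x → Deficit π t d → DeficitAtMost π (suc t) c → d + (negPart x + ν t) ≤ posPart x + c
  deficit-next-≤ π t {d} {c} x refl def bound = ℕP.+-cancelˡ-≤ (Σpos π t) _ _ (begin
    Σpos π t + (d + (negPart x + ν t))     ≡⟨ sym (ℕP.+-assoc (Σpos π t) d _) ⟩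
    (Σpos π t + d) + (negPart x + ν t)     ≡⟨ cong (_+ (negPart x + ν t)) (sym def) ⟩
    (Σneg π t + Σν t) + (negPart x + ν t)
      ≡⟨ solve 4 (λ a b c e → (a :+ c) :+ (b :+ e) := (a :+ b) :+ (c :+ e)) refl (Σneg π t) (negPart x) (Σν t) (ν t) ⟩
    (Σneg π t + negPart x) + (Σν t + ν t)  ≤⟨ bound ⟩
    (Σpos π t + posPart x) + c             ≡⟨ ℕP.+-assoc (Σpos π t) _ c ⟩
    Σpos π t + (posPart x + c)             ∎)
    where open ℕP.≤-Reasoning

  deficit-fixed : ∀ π t {d} → π t ≡ (true , t) → Deficit π t d → Deficit π (suc t) d
  deficit-fixed π t {d} e def = deficit-next π t _ d e def (ℕP.+-comm d (ν t))

  ν-shift : ∀ t k → 1 ≤ t → t + k ≤ R → ν t ≡ ν (t + k) + k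
  ν-shift (suc t) k _ t+k≤R = sym (begin
    (R ∸ (suc t + k)) + k  ≡⟨ cong (_+ k) (sym (ℕP.∸-+-assoc R (suc t) k)) ⟩
    (R ∸ suc t ∸ k) + k    ≡⟨ ℕP.m∸n+n≡m (ℕP.m+n≤o⇒m≤o∸n k (subst (_≤ R) (ℕP.+-comm (suc t) k) t+k≤R)) ⟩
    R ∸ suc t              ∎)
    where open ≡-Reasoning

  ν-positive : ∀ t → 1 ≤ t → t < R → 0 < ν t
  ν-positive (suc t) _ t<R = ℕP.m<n⇒0<n∸m t<R

  -- On positive indices ν is R − p, so a bound between ν-values bounds the indices.
  ν-cancel : ∀ p t d c → 1 ≤ p → 1 ≤ t → p ≤ R → t ≤ R → d + ν t ≤ ν p + c → p + d ≤ t + c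
  ν-cancel (suc p) (suc t) d c _ _ p≤R t≤R ν-bound = ℕP.+-cancelˡ-≤ (R ∸ suc t) _ _ (begin
    (R ∸ suc t) + (suc p + d)        ≡⟨ solve 3 (λ a b e → a :+ (b :+ e) := b :+ (e :+ a)) refl (R ∸ suc t) (suc p) d ⟩
    suc p + (d + (R ∸ suc t))        ≤⟨ ℕP.+-monoʳ-≤ (suc p) ν-bound ⟩
    suc p + ((R ∸ suc p) + c)        ≡⟨ sym (ℕP.+-assoc (suc p) _ c) ⟩
    (suc p + (R ∸ suc p)) + c        ≡⟨ cong (_+ c) (trans (ℕP.m+[n∸m]≡n p≤R) (sym (ℕP.m∸n+n≡m t≤R))) ⟩
    ((R ∸ suc t) + suc t) + c        ≡⟨ ℕP.+-assoc (R ∸ suc t) (suc t) c ⟩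
    (R ∸ suc t) + (suc t + c)        ∎)
    where open ℕP.≤-Reasoning

  deficit-forward : ∀ π t {d} k {p} → π t ≡ (true , p) → t + k ≡ p → 1 ≤ t → p ≤ R → Deficit π t d → Deficit π (suc t) (d + k)
  deficit-forward π t {d} k e refl 1≤t p≤R def = deficit-next π t _ (d + k) e def (begin
    d + ν t              ≡⟨ cong (d +_) (ν-shift t k 1≤t p≤R) ⟩
    d + (ν (t + k) + k)  ≡⟨ solve 3 (λ a b e → a :+ (b :+ e) := b :+ (a :+ e)) refl d (ν (t + k)) k ⟩
    ν (t + k) + (d + k)  ∎)
    where open ≡-Reasoning

  deficit-backward : ∀ π t {d} k {p} → π t ≡ (true , p) → p + k ≡ t → 1 ≤ p → t ≤ R → Deficit π t (d + k) → Deficit π (suc t) d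
  deficit-backward π t {d} k {p} e refl 1≤p t≤R def = deficit-next π t _ d e def (begin
    (d + k) + ν (p + k)  ≡⟨ solve 3 (λ a b e → (a :+ e) :+ b := (b :+ e) :+ a) refl d (ν (p + k)) k ⟩
    (ν (p + k) + k) + d  ≡⟨ cong (_+ d) (sym (ν-shift p k 1≤p t≤R)) ⟩
    ν p + d              ∎)
    where open ≡-Reasoning

  -- For t + f = R + 1: the words a₁ ∷ a₂ ∷ ⋯ with t ≤ a₁, a_{i+1} ≥ a_i + 2 and a_i ≤ R, i.e. products
  -- of commuting s_{a+1} (the letter R being the sign change s_{R+1}); there are F_{f+2} of them.
  fibWords : ℕ → ℕ → List (List ℕ)
  fibWords zero t = [] ∷ []
  fibWords (suc zero) t = [] ∷ (t ∷ []) ∷ []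
  fibWords (suc (suc f)) t = fibWords (suc f) (suc t) ++ map (t ∷_) (fibWords f (suc (suc t)))

  ∈-fibWords-split : ∀ {f t τ} → τ ∈ fibWords (suc (suc f)) t →
    τ ∈ fibWords (suc f) (suc t) ⊎ ∃[ τ′ ] (τ′ ∈ fibWords f (suc (suc t)) × τ ≡ t ∷ τ′)
  ∈-fibWords-split {f} {t} τ∈ = Data.Sum.map₂ (∈-map⁻ (t ∷_)) (∈-++⁻ (fibWords (suc f) (suc t)) τ∈)

  fibWords-elim : ∀ f t (P : List ℕ → Set) → (∀ τ → τ ∈ fibWords (suc f) (suc t) → P τ) →
    (∀ τ → τ ∈ fibWords f (suc (suc t)) → P (t ∷ τ)) → ∀ τ → τ ∈ fibWords (suc (suc f)) t → P τ
  fibWords-elim f t P P₁ P₂ τ τ∈ with ∈-fibWords-split {f} τ∈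
  ... | inj₁ τ∈₁ = P₁ τ τ∈₁
  ... | inj₂ (τ′ , τ′∈ , refl) = P₂ τ′ τ′∈

  fibWords-≥ : ∀ f t τ → τ ∈ fibWords f t → All (t ≤_) τ
  fibWords-≥ zero t .[] (here refl) = []
  fibWords-≥ (suc zero) t .[] (here refl) = []
  fibWords-≥ (suc zero) t .(t ∷ []) (there (here refl)) = ℕP.≤-refl ∷ []
  fibWords-≥ (suc (suc f)) t = fibWords-elim f t (All (t ≤_))
    (λ τ τ∈ → All.map (ℕP.≤-trans (ℕP.n≤1+n t)) (fibWords-≥ (suc f) (suc t) τ τ∈))
    (λ τ τ∈ → ℕP.≤-refl ∷ All.map (ℕP.≤-trans (ℕP.m≤n⇒m≤1+n (ℕP.n≤1+n t))) (fibWords-≥ f (suc (suc t)) τ τ∈))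

  lastWord : Bool → List ℕ
  lastWord true = []
  lastWord false = R ∷ []

  lastWord∈ : ∀ b → lastWord b ∈ fibWords 1 R
  lastWord∈ true = here refl
  lastWord∈ false = there (here refl)

  perm-lastWord : ∀ b → perm (lastWord b) R ≡ (b , R)
  perm-lastWord true = refl
  perm-lastWord false rewrite ≡ᵇ-refl R = refl

  fuel-last : ∀ {t} → t + 1 ≡ suc R → t ≡ R
  fuel-last {t} e = ℕP.suc-injective (trans (ℕP.+-comm 1 t) e)

  fuel-shift : ∀ {t f} → t + suc f ≡ suc R → suc t + f ≡ suc R
  fuel-shift {t} {f} e = trans (sym (ℕP.+-suc t f)) e

  fuel-< : ∀ {t f} → t + suc (suc f) ≡ suc R → t < R
  fuel-< {t} {f} e = ℕP.≤-pred (subst (suc t <_) (fuel-shift e) (ℕP.m<m+n (suc t) (s≤s z≤n)))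

  AgreesFrom : (ℕ → SignedIndex) → List ℕ → ℕ → Set
  AgreesFrom π τ t = ∀ i → t ≤ i → i ≤ R → π i ≡ perm τ i

  agreesFrom-fixed : ∀ {π τ t} → All (suc t ≤_) τ → π t ≡ (true , t) → AgreesFrom π τ (suc t) → AgreesFrom π τ t
  agreesFrom-fixed {τ = τ} {t} t<τ e agree i t≤i i≤R with ℕP.m≤n⇒m<n∨m≡n t≤i
  ... | inj₁ t<i = agree i t<i i≤R
  ... | inj₂ refl = trans e (sym (perm-below τ (suc t) t<τ t (ℕP.n<1+n t)))

  perm-swapped-left : ∀ {t τ} → t < R → All (suc (suc t) ≤_) τ → perm (t ∷ τ) t ≡ (true , suc t)
  perm-swapped-left {t} {τ} t<R t+2≤τ = trans (perm-swap t τ t t<R)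
    (trans (cong (perm τ) (swapAdj-left t)) (perm-below τ (suc (suc t)) t+2≤τ (suc t) (ℕP.n<1+n (suc t))))

  perm-swapped-right : ∀ {t τ} → t < R → All (suc (suc t) ≤_) τ → perm (t ∷ τ) (suc t) ≡ (true , t)
  perm-swapped-right {t} {τ} t<R t+2≤τ = trans (perm-swap t τ (suc t) t<R)
    (trans (cong (perm τ) (swapAdj-right t)) (perm-below τ (suc (suc t)) t+2≤τ t (ℕP.m<n⇒m<1+n (ℕP.n<1+n t))))

  perm-swapped-beyond : ∀ {t τ} → t < R → ∀ i → suc (suc t) ≤ i → perm (t ∷ τ) i ≡ perm τ i
  perm-swapped-beyond {t} {τ} t<R i t+2≤i = trans (perm-swap t τ i t<R) (cong (perm τ) (swapAdj-above t i t+2≤i))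

  agreesFrom-swapped : ∀ {π τ t} → t < R → All (suc (suc t) ≤_) τ → π t ≡ (true , suc t) → π (suc t) ≡ (true , t) →
    AgreesFrom π τ (suc (suc t)) → AgreesFrom π (t ∷ τ) t
  agreesFrom-swapped {τ = τ} {t} t<R t+2≤τ e e′ agree i t≤i i≤R with ℕP.m≤n⇒m<n∨m≡n t≤i
  ... | inj₂ refl = trans e (sym (perm-swapped-left t<R t+2≤τ))
  ... | inj₁ t<i with ℕP.m≤n⇒m<n∨m≡n t<i
  ... | inj₂ refl = trans e′ (sym (perm-swapped-right t<R t+2≤τ))
  ... | inj₁ t+2≤i = trans (agree i t+2≤i i≤R) (sym (perm-swapped-beyond {τ = τ} t<R i t+2≤i))

  perm-cycle : ∀ τ i → 3 ≤ R → perm (1 ∷ 2 ∷ τ) i ≡ perm τ (swapAdj 2 (swapAdj 1 i))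
  perm-cycle τ i 3≤R = trans (perm-swap 1 (2 ∷ τ) i (ℕP.≤-trans (ℕP.n≤1+n 2) 3≤R)) (perm-swap 2 τ (swapAdj 1 i) 3≤R)

  perm-cycle-below : ∀ τ → 3 ≤ R → All (4 ≤_) τ → ∀ i → i < 4 → perm (1 ∷ 2 ∷ τ) i ≡ (true , swapAdj 2 (swapAdj 1 i))
  perm-cycle-below τ 3≤R 4≤τ i i<4 = trans (perm-cycle τ i 3≤R) (perm-below τ 4 4≤τ _ (image-< i i<4))
    where
    image-< : ∀ i → i < 4 → swapAdj 2 (swapAdj 1 i) < 4
    image-< 0 _ = s≤s z≤n
    image-< 1 _ = ℕP.≤-refl
    image-< 2 _ = s≤s (s≤s z≤n)
    image-< 3 _ = s≤s (s≤s (s≤s z≤n))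
    image-< (suc (suc (suc (suc _)))) (s≤s (s≤s (s≤s (s≤s ()))))

  perm-cycle-beyond : ∀ τ → 3 ≤ R → ∀ i → 4 ≤ i → perm (1 ∷ 2 ∷ τ) i ≡ perm τ i
  perm-cycle-beyond τ 3≤R i@(suc (suc (suc (suc _)))) _ = perm-cycle τ i 3≤R
  perm-cycle-beyond τ 3≤R 1 (s≤s ())
  perm-cycle-beyond τ 3≤R 2 (s≤s (s≤s ()))
  perm-cycle-beyond τ 3≤R 3 (s≤s (s≤s (s≤s ())))

  agreesFrom-cycle : ∀ {π τ} → 3 ≤ R → All (4 ≤_) τ → π 0 ≡ (true , 0) → π 1 ≡ (true , 3) → π 2 ≡ (true , 1) →
    π 3 ≡ (true , 2) → AgreesFrom π τ 4 → AgreesFrom π (1 ∷ 2 ∷ τ) 0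
  agreesFrom-cycle {τ = τ} 3≤R 4≤τ e₀ e₁ e₂ e₃ agree = λ where
      0 _ _ → trans e₀ (sym (perm-cycle-below τ 3≤R 4≤τ 0 (s≤s z≤n)))
      1 _ _ → trans e₁ (sym (perm-cycle-below τ 3≤R 4≤τ 1 (s≤s (s≤s z≤n))))
      2 _ _ → trans e₂ (sym (perm-cycle-below τ 3≤R 4≤τ 2 (s≤s (s≤s (s≤s z≤n)))))
      3 _ _ → trans e₃ (sym (perm-cycle-below τ 3≤R 4≤τ 3 ℕP.≤-refl))
      i@(suc (suc (suc (suc _)))) _ i≤R → trans (agree i 4≤i i≤R) (sym (perm-cycle-beyond τ 3≤R i 4≤i))
    where
    4≤i : ∀ {n} → 4 ≤ suc (suc (suc (suc n)))
    4≤i = s≤s (s≤s (s≤s (s≤s z≤n)))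

  Covers : (ℕ → SignedIndex) → ℕ → Set
  Covers π t = ∀ p → p < t → ∃[ i ] (i < t × index (π i) ≡ p)

  covers-next : ∀ {π t} → Covers π t → index (π t) ≡ t → Covers π (suc t)
  covers-next {t = t} cov e p p<t+1 with ℕP.m≤n⇒m<n∨m≡n (ℕP.≤-pred p<t+1)
  ... | inj₁ p<t = let (i , i<t , eᵢ) = cov p p<t in i , ℕP.m<n⇒m<1+n i<t , eᵢ
  ... | inj₂ refl = t , ℕP.n<1+n t , e

  covers-swap : ∀ {π t} → Covers π t → index (π t) ≡ suc t → index (π (suc t)) ≡ t → Covers π (suc (suc t))
  covers-swap {t = t} cov e e′ p p<t+2 with ℕP.m≤n⇒m<n∨m≡n (ℕP.≤-pred p<t+2)
  ... | inj₂ refl = t , ℕP.m<n⇒m<1+n (ℕP.n<1+n t) , e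
  ... | inj₁ p<t+1 with ℕP.m≤n⇒m<n∨m≡n (ℕP.≤-pred p<t+1)
  ... | inj₂ refl = suc t , ℕP.n<1+n (suc t) , e′
  ... | inj₁ p<t = let (i , i<t , eᵢ) = cov p p<t in i , ℕP.<-trans i<t (ℕP.<-trans (ℕP.n<1+n t) (ℕP.n<1+n (suc t))) , eᵢ

  covers-zero : ∀ {π} → Covers π 0
  covers-zero p ()

  fuel : ∀ k → k ≤ R → suc k + (R ∸ k) ≡ suc R
  fuel k k≤R = cong suc (ℕP.m+[n∸m]≡n k≤R)

  -- Coordinate 0 fixed, coordinates 1, 2, 3 acted on by 1, s₂ or s₂s₃, followed by a word of fibWords.
  allWords : List (List ℕ)
  allWords = fibWords (R ∸ 1) 2 ++ (map (1 ∷_) (fibWords (R ∸ 2) 3) ++ map (λ τ → 1 ∷ 2 ∷ τ) (fibWords (R ∸ 3) 4))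

  -- The signed permutations allowed by the prefix-sum inequalities beyond position 3.
  record Admissible (π : ℕ → SignedIndex) : Set where
    field
      index-injective : ∀ i j → index (π i) ≡ index (π j) → i ≡ j
      index-≤ : ∀ i → i ≤ R → index (π i) ≤ R
      deficit-≤1 : ∀ s → 3 ≤ s → s ≤ suc R → DeficitAtMost π s 1

  module _ {π : ℕ → SignedIndex} (adm : Admissible π) where

    open Admissible adm

    covers⇒index-≥ : ∀ {t} → Covers π t → ∀ i → t ≤ i → t ≤ index (π i)
    covers⇒index-≥ {t} cov i t≤i with t ≤? index (π i)
    ... | yes t≤πi = t≤πi
    ... | no t≰πi with cov (index (π i)) (ℕP.≰⇒> t≰πi)
    ... | i′ , i′<t , e = ⊥-elim (ℕP.<⇒≢ (ℕP.<-≤-trans i′<t t≤i) (index-injective i′ i e))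

    positive-step : ∀ {t d b p} → 2 ≤ t → t ≤ R → 0 < d + ν t → Deficit π t d → π t ≡ (b , p) → 1 ≤ p →
      b ≡ true × p + d ≤ suc t
    positive-step {t} {d} {false} {p} 2≤t t≤R 0<d+νt def e _ = ⊥-elim (ℕP.<-irrefl refl (ℕP.<-≤-trans 0<d+νt d+νt≤0))
      where
      bound : d + suc (ν p + ν t) ≤ 0 + 1
      bound = deficit-next-≤ π t _ e def (deficit-≤1 (suc t) (s≤s 2≤t) (s≤s t≤R))
      d+νt≤0 : d + ν t ≤ 0
      d+νt≤0 = ℕP.≤-pred (ℕP.≤-trans (s≤s (ℕP.+-monoʳ-≤ d (ℕP.m≤n+m (ν t) (ν p))))
        (subst (_≤ 1) (ℕP.+-suc d (ν p + ν t)) bound))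
    positive-step {t} {d} {true} {p} 2≤t t≤R _ def e 1≤p = refl , subst (p + d ≤_) (ℕP.+-comm t 1)
      (ν-cancel p t d 1 1≤p (ℕP.≤-trans (s≤s z≤n) 2≤t) (subst (_≤ R) (cong index e) (index-≤ t t≤R)) t≤R
        (deficit-next-≤ π t _ e def (deficit-≤1 (suc t) (s≤s 2≤t) (s≤s t≤R))))

    fixed-or-swapped : ∀ {t b p} → 2 ≤ t → t < R → Deficit π t 0 → Covers π t → π t ≡ (b , p) →
      b ≡ true × (p ≡ t ⊎ p ≡ suc t)
    fixed-or-swapped {t} {b} {p} 2≤t t<R def cov e = Data.Product.map₂ t≤p≤t+1 (positive-step 2≤t (ℕP.<⇒≤ t<R) 0<νt def e 1≤p)
      where
      1≤t : 1 ≤ t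
      1≤t = ℕP.≤-trans (s≤s z≤n) 2≤t
      0<νt : 0 < 0 + ν t
      0<νt = ν-positive t 1≤t t<R
      t≤p : t ≤ p
      t≤p = subst (t ≤_) (cong index e) (covers⇒index-≥ cov t ℕP.≤-refl)
      1≤p : 1 ≤ p
      1≤p = ℕP.≤-trans 1≤t t≤p
      t≤p≤t+1 : p + 0 ≤ suc t → p ≡ t ⊎ p ≡ suc t
      t≤p≤t+1 p≤t+1 = Data.Sum.map₁ (λ p<t+1 → ℕP.≤-antisym (ℕP.≤-pred p<t+1) t≤p)
                                    (ℕP.m≤n⇒m<n∨m≡n (subst (_≤ suc t) (ℕP.+-identityʳ p) p≤t+1))

    swap-partner : ∀ {t} → 1 ≤ t → t < R → Deficit π (suc t) 1 → Covers π t → π t ≡ (true , suc t) → π (suc t) ≡ (true , t)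
    swap-partner {t} 1≤t t<R def cov e with π (suc t) in e′
    ... | (b′ , p′) = cong₂ _,_ b′≡true (ℕP.≤-antisym (ℕP.≤-pred (ℕP.≤∧≢⇒< p′≤t+1 p′≢t+1)) t≤p′)
      where
      t≤p′ : t ≤ p′
      t≤p′ = subst (t ≤_) (cong index e′) (covers⇒index-≥ cov (suc t) (ℕP.n≤1+n t))
      step : b′ ≡ true × p′ + 1 ≤ suc (suc t)
      step = positive-step (s≤s 1≤t) t<R (s≤s z≤n) def e′ (ℕP.≤-trans 1≤t t≤p′)
      b′≡true : b′ ≡ true
      b′≡true = proj₁ step
      p′≤t+1 : p′ ≤ suc t
      p′≤t+1 = ℕP.≤-pred (subst (_≤ suc (suc t)) (ℕP.+-comm p′ 1) (proj₂ step))
      p′≢t+1 : p′ ≢ suc t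
      p′≢t+1 p′≡t+1 = ℕP.<⇒≢ (ℕP.n<1+n t) (index-injective t (suc t) (trans (cong index e) (trans (sym p′≡t+1) (sym (cong index e′)))))

    TailClassification : ℕ → Set
    TailClassification f = ∀ t → t + f ≡ suc R → 2 ≤ t → Deficit π t 0 → Covers π t →
      ∃[ τ ] (τ ∈ fibWords f t × AgreesFrom π τ t)

    classifyTail-last : TailClassification 1
    classifyTail-last t e _ _ cov with fuel-last e
    ... | refl with π R in eᵣ
    ... | (b , p) = lastWord b , lastWord∈ b , λ i R≤i i≤R →
      subst (λ i → π i ≡ perm (lastWord b) i) (ℕP.≤-antisym R≤i i≤R) (trans eᵣ (trans (cong (b ,_) p≡R) (sym (perm-lastWord b))))
      where
      p≡R : p ≡ R
      p≡R = ℕP.≤-antisym (subst (_≤ R) (cong index eᵣ) (index-≤ R ℕP.≤-refl))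
                          (subst (R ≤_) (cong index eᵣ) (covers⇒index-≥ cov R ℕP.≤-refl))

    classifyTail-step : ∀ f → TailClassification (suc f) → TailClassification f → TailClassification (suc (suc f))
    classifyTail-step f classify₁ classify₂ t e 2≤t def cov with π t in eₜ
    ... | (b , p) with fixed-or-swapped 2≤t (fuel-< e) def cov eₜ
    ... | refl , inj₁ refl =
      let τ , τ∈ , agree = classify₁ (suc t) (fuel-shift {t} e) (ℕP.m≤n⇒m≤1+n 2≤t) (deficit-fixed π t {0} eₜ def) (covers-next {π} {t} cov (cong index eₜ))
      in τ , ∈-++⁺ˡ τ∈ , agreesFrom-fixed (fibWords-≥ (suc f) (suc t) τ τ∈) eₜ agree
    ... | refl , inj₂ refl =
      let τ , τ∈ , agree = classify₂ (suc (suc t)) (fuel-shift {suc t} (fuel-shift {t} e)) (ℕP.m≤n⇒m≤1+n (ℕP.m≤n⇒m≤1+n 2≤t)) def₂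
                             (covers-swap {π} {t} cov (cong index eₜ) (cong index eₜ₊₁))
      in t ∷ τ , ∈-++⁺ʳ (fibWords (suc f) (suc t)) (∈-map⁺ (t ∷_) τ∈) ,
         agreesFrom-swapped t<R (fibWords-≥ f (suc (suc t)) τ τ∈) eₜ eₜ₊₁ agree
      where
      t<R : t < R
      t<R = fuel-< e
      1≤t : 1 ≤ t
      1≤t = ℕP.≤-trans (s≤s z≤n) 2≤t
      def₁ : Deficit π (suc t) 1
      def₁ = deficit-forward π t 1 eₜ (ℕP.+-comm t 1) 1≤t t<R def
      eₜ₊₁ : π (suc t) ≡ (true , t)
      eₜ₊₁ = swap-partner 1≤t t<R def₁ cov eₜ
      def₂ : Deficit π (suc (suc t)) 0
      def₂ = deficit-backward π (suc t) 1 eₜ₊₁ (ℕP.+-comm t 1) 1≤t t<R def₁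

    classifyTail : ∀ f → TailClassification f
    classifyTail zero t e _ _ _ = [] , here refl , λ i t≤i i≤R →
      ⊥-elim (ℕP.<-irrefl refl (ℕP.≤-trans (subst (_≤ i) (trans (sym (ℕP.+-identityʳ t)) e) t≤i) i≤R))
    classifyTail (suc zero) = classifyTail-last
    classifyTail (suc (suc f)) = classifyTail-step f (classifyTail (suc f)) (classifyTail f)

    module _ (3≤R : 3 ≤ R) (e₀ : π 0 ≡ (true , 0)) where

      private
        1≤R : 1 ≤ R
        1≤R = ℕP.≤-trans (s≤s z≤n) 3≤R
        2≤R : 2 ≤ R
        2≤R = ℕP.≤-trans (s≤s (s≤s z≤n)) 3≤R

        def₁ : Deficit π 1 0
        def₁ = deficit-fixed π 0 e₀ refl

        cov₁ : Covers π 1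
        cov₁ = covers-next {π} {0} (covers-zero {π}) (cong index e₀)

        index-positive : ∀ {i b p} → 1 ≤ i → π i ≡ (b , p) → 1 ≤ p
        index-positive {i} 1≤i e = ℕP.n≢0⇒n>0 λ p≡0 →
          ℕP.<⇒≢ 1≤i (index-injective 0 i (trans (cong index e₀) (sym (trans (cong index e) p≡0))))

        index-distinct : ∀ {i j x y} → i ≢ j → π i ≡ x → π j ≡ y → index x ≢ index y
        index-distinct {i} {j} i≢j eᵢ eⱼ e = i≢j (index-injective i j (trans (cong index eᵢ) (trans e (sym (cong index eⱼ)))))

        -- Position 2 lowers the deficit by at most 1 (its index is not 0) and leaves at most 1,
        -- so position 1 raises it by at most 2.
        first-index : ∀ {b p} → π 1 ≡ (b , p) → b ≡ true × 1 ≤ p × p ≤ 3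
        first-index e₁ with π 2 in e₂
        first-index {false} {p} e₁ | (b₂ , p₂) = ⊥-elim (ℕP.<-irrefl refl (ℕP.<-≤-trans (ℕP.n<1+n 3) (ℕP.≤-trans lower (proj₂ step))))
          where
          def₂ : Deficit π 2 (suc (ν p) + ν 1)
          def₂ = deficit-next π 1 _ _ e₁ def₁ refl
          step : b₂ ≡ true × p₂ + (suc (ν p) + ν 1) ≤ 3
          step = positive-step {2} ℕP.≤-refl 2≤R (s≤s z≤n) def₂ e₂ (index-positive (s≤s z≤n) e₂)
          lower : 4 ≤ p₂ + (suc (ν p) + ν 1)
          lower = ℕP.+-mono-≤ (index-positive (s≤s z≤n) e₂) (ℕP.+-mono-≤ (s≤s (z≤n {ν p})) (ℕP.∸-monoˡ-≤ 1 3≤R))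
        first-index {true} {zero} e₁ | _ = ⊥-elim (ℕP.<-irrefl refl (index-positive (s≤s z≤n) e₁))
        first-index {true} {suc p} e₁ | (b₂ , p₂) =
          refl , s≤s z≤n , ℕP.≤-trans (ℕP.+-monoˡ-≤ p (index-positive (s≤s z≤n) e₂)) (proj₂ step)
          where
          def₂ : Deficit π 2 (0 + p)
          def₂ = deficit-forward π 1 p e₁ refl (s≤s z≤n) (subst (_≤ R) (cong index e₁) (index-≤ 1 1≤R)) def₁
          step : b₂ ≡ true × p₂ + (0 + p) ≤ 3
          step = positive-step {2} ℕP.≤-refl 2≤R (ℕP.<-≤-trans (ν-positive 2 (s≤s z≤n) 3≤R) (ℕP.m≤n+m (ν 2) p)) def₂ e₂
                               (index-positive (s≤s z≤n) e₂)

        Classified : Set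
        Classified = ∃[ τ ] (τ ∈ allWords × AgreesFrom π τ 0)

        head-fixed : π 1 ≡ (true , 1) → Classified
        head-fixed e₁ = finish (classifyTail (R ∸ 1) 2 (fuel 1 1≤R) ℕP.≤-refl (deficit-fixed π 1 e₁ def₁) (covers-next {π} {1} cov₁ (cong index e₁)))
          where
          finish : ∃[ τ ] (τ ∈ fibWords (R ∸ 1) 2 × AgreesFrom π τ 2) → Classified
          finish (τ , τ∈ , agree) = τ , ∈-++⁺ˡ τ∈ ,
            agreesFrom-fixed (All.map (ℕP.≤-trans (ℕP.n≤1+n 1)) 2≤τ) e₀ (agreesFrom-fixed 2≤τ e₁ agree)
            where
            2≤τ : All (2 ≤_) τ
            2≤τ = fibWords-≥ (R ∸ 1) 2 τ τ∈

        head-swapped : π 1 ≡ (true , 2) → Classified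
        head-swapped e₁ = finish (classifyTail (R ∸ 2) 3 (fuel 2 2≤R) (s≤s (s≤s z≤n)) def₃ (covers-swap {π} {1} cov₁ (cong index e₁) (cong index e₂)))
          where
          def₂ : Deficit π 2 1
          def₂ = deficit-forward π 1 1 e₁ refl (s≤s z≤n) 2≤R def₁
          e₂ : π 2 ≡ (true , 1)
          e₂ = swap-partner (s≤s z≤n) 2≤R def₂ cov₁ e₁
          def₃ : Deficit π 3 0
          def₃ = deficit-backward π 2 1 e₂ refl (s≤s z≤n) 2≤R def₂
          finish : ∃[ τ ] (τ ∈ fibWords (R ∸ 2) 3 × AgreesFrom π τ 3) → Classified
          finish (τ , τ∈ , agree) = 1 ∷ τ , ∈-++⁺ʳ (fibWords (R ∸ 1) 2) (∈-++⁺ˡ (∈-map⁺ (1 ∷_) τ∈)) ,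
            agreesFrom-fixed (ℕP.≤-refl ∷ All.map (ℕP.≤-trans (s≤s z≤n)) 3≤τ) e₀ (agreesFrom-swapped 2≤R 3≤τ e₁ e₂ agree)
            where
            3≤τ : All (3 ≤_) τ
            3≤τ = fibWords-≥ (R ∸ 2) 3 τ τ∈

        head-cycle : π 1 ≡ (true , 3) → Classified
        head-cycle e₁ = finish (classifyTail (R ∸ 3) 4 (fuel 3 3≤R) (s≤s (s≤s z≤n)) def₄ cov₄)
          where
          def₂ : Deficit π 2 2
          def₂ = deficit-forward π 1 2 e₁ refl (s≤s z≤n) 3≤R def₁
          e₂ : π 2 ≡ (true , 1)
          e₂ with π 2 in e
          ... | (b₂ , p₂) with positive-step {2} ℕP.≤-refl 2≤R (s≤s z≤n) def₂ e (index-positive (s≤s z≤n) e)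
          ... | refl , p₂+2≤3 = cong (true ,_) (ℕP.≤-antisym (ℕP.+-cancelʳ-≤ 2 p₂ 1 p₂+2≤3) (index-positive (s≤s z≤n) e))
          def₃ : Deficit π 3 1
          def₃ = deficit-backward π 2 1 e₂ refl (s≤s z≤n) 2≤R def₂
          pin : ∀ p → 1 ≤ p → suc p ≤ 4 → p ≢ 1 → p ≢ 3 → p ≡ 2
          pin 0 () _ _ _
          pin 1 _ _ p≢1 _ = ⊥-elim (p≢1 refl)
          pin 2 _ _ _ _ = refl
          pin 3 _ _ _ p≢3 = ⊥-elim (p≢3 refl)
          pin (suc (suc (suc (suc _)))) _ (s≤s (s≤s (s≤s (s≤s ())))) _ _
          e₃ : π 3 ≡ (true , 2)
          e₃ with π 3 in e
          ... | (b₃ , p₃) with positive-step {3} (s≤s (s≤s z≤n)) 3≤R (s≤s z≤n) def₃ e (index-positive (s≤s z≤n) e)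
          ... | refl , p₃+1≤4 = cong (true ,_) (pin p₃ (index-positive (s≤s z≤n) e) (subst (_≤ 4) (ℕP.+-comm p₃ 1) p₃+1≤4)
                                                    (index-distinct (λ ()) e e₂) (index-distinct (λ ()) e e₁))
          def₄ : Deficit π 4 0
          def₄ = deficit-backward π 3 1 e₃ refl (s≤s z≤n) 3≤R def₃
          cov₄ : Covers π 4
          cov₄ 0 _ = 0 , s≤s z≤n , cong index e₀
          cov₄ 1 _ = 2 , s≤s (s≤s (s≤s z≤n)) , cong index e₂
          cov₄ 2 _ = 3 , ℕP.≤-refl , cong index e₃
          cov₄ 3 _ = 1 , s≤s (s≤s z≤n) , cong index e₁
          cov₄ (suc (suc (suc (suc _)))) (s≤s (s≤s (s≤s (s≤s ()))))
          finish : ∃[ τ ] (τ ∈ fibWords (R ∸ 3) 4 × AgreesFrom π τ 4) → Classified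
          finish (τ , τ∈ , agree) = 1 ∷ 2 ∷ τ ,
            ∈-++⁺ʳ (fibWords (R ∸ 1) 2) (∈-++⁺ʳ (map (1 ∷_) (fibWords (R ∸ 2) 3)) (∈-map⁺ (λ τ → 1 ∷ 2 ∷ τ) τ∈)) ,
            agreesFrom-cycle 3≤R 4≤τ e₀ e₁ e₂ e₃ agree
            where
            4≤τ : All (4 ≤_) τ
            4≤τ = fibWords-≥ (R ∸ 3) 4 τ τ∈

      classifyHead : ∃[ τ ] (τ ∈ allWords × AgreesFrom π τ 0)
      classifyHead with π 1 in e₁
      ... | (b , p) with first-index e₁
      ... | refl , 1≤p , p≤3 = from p e₁ 1≤p p≤3
        where
        from : ∀ p → π 1 ≡ (true , p) → 1 ≤ p → p ≤ 3 → Classified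
        from 1 e _ _ = head-fixed e
        from 2 e _ _ = head-swapped e
        from 3 e _ _ = head-cycle e
        from (suc (suc (suc (suc _)))) _ _ (s≤s (s≤s (s≤s ())))

  fixes-first : ∀ π c → c < ℓ → DeficitAtMost π 1 c → π 0 ≡ (true , 0)
  fixes-first π c c<ℓ bound = first (π 0) refl
    where
    first : ∀ x → π 0 ≡ x → π 0 ≡ (true , 0)
    first (false , p) e = ⊥-elim (ℕP.<⇒≱ c<ℓ (ℕP.≤-trans (ℕP.m≤m+n ℓ R) (ℕP.≤-trans (ℕP.m≤n+m (ℓ + R) (suc (ν p)))
                                  (deficit-next-≤ π 0 _ e refl bound))))
    first (true , zero) e = e
    first (true , suc p) e = ⊥-elim (ℕP.<⇒≱ c<ℓ (ℕP.+-cancelʳ-≤ R ℓ c (ℕP.≤-trans (deficit-next-≤ π 0 _ e refl bound)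
                                  (ℕP.≤-trans (ℕP.+-monoˡ-≤ c (ℕP.m∸n≤m R (suc p))) (ℕP.≤-reflexive (ℕP.+-comm R c))))))

  deficit⇒atMost : ∀ π s {d c} → Deficit π s d → d ≤ c → DeficitAtMost π s c
  deficit⇒atMost π s {c = c} def d≤c = subst (_≤ Σpos π s + c) (sym def) (ℕP.+-monoʳ-≤ (Σpos π s) d≤c)

  atMost-mono : ∀ π s {c c′} → c ≤ c′ → DeficitAtMost π s c → DeficitAtMost π s c′
  atMost-mono π s c≤c′ bound = ℕP.≤-trans bound (ℕP.+-monoʳ-≤ (Σpos π s) c≤c′)

  Deficits≤1From : (ℕ → SignedIndex) → ℕ → Set
  Deficits≤1From π t = ∀ s → t ≤ s → s ≤ suc R → DeficitAtMost π s 1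

  perm-fibWords₁ : ∀ {τ} → τ ∈ fibWords 1 R → ∃[ b ] (perm τ R ≡ (b , R))
  perm-fibWords₁ (here refl) = true , refl
  perm-fibWords₁ (there (here refl)) = false , perm-lastWord false

  beyond-last : ∀ π b → 1 ≤ R → π R ≡ (b , R) → Deficit π R 0 → DeficitAtMost π (suc R) 1
  beyond-last π true _ e def = deficit⇒atMost π (suc R) (deficit-next π R _ 0 e def (sym (ℕP.+-identityʳ (ν R)))) z≤n
  beyond-last π false 1≤R e def =
    deficit⇒atMost π (suc R) (deficit-next π R _ 1 e def (cong (λ n → suc (n + n)) (ν-last R 1≤R refl))) ℕP.≤-refl
    where
    ν-last : ∀ t → 1 ≤ t → t ≡ R → ν t ≡ 0
    ν-last (suc t) _ e = trans (cong (R ∸_) e) (ℕP.n∸n≡0 R)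

  FibWordsDeficit : ℕ → Set
  FibWordsDeficit f = ∀ t τ → τ ∈ fibWords f t → t + f ≡ suc R → 1 ≤ t → ∀ π → AgreesFrom π τ t → Deficit π t 0 →
    Deficits≤1From π t

  fibWords-deficit-fixed : ∀ f → FibWordsDeficit (suc f) → ∀ t τ → τ ∈ fibWords (suc f) (suc t) → t + suc (suc f) ≡ suc R →
    ∀ π → AgreesFrom π τ t → Deficit π t 0 → Deficits≤1From π t
  fibWords-deficit-fixed f next t τ τ∈ e π agree def s t≤s s≤R+1 with ℕP.m≤n⇒m<n∨m≡n t≤s
  ... | inj₂ refl = deficit⇒atMost π t def z≤n
  ... | inj₁ t<s = next (suc t) τ τ∈ (fuel-shift {t} e) (s≤s z≤n) π (λ i t<i → agree i (ℕP.<⇒≤ t<i)) (deficit-fixed π t eₜ def) s t<s s≤R+1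
    where
    eₜ : π t ≡ (true , t)
    eₜ = trans (agree t ℕP.≤-refl (ℕP.<⇒≤ (fuel-< e))) (perm-below τ (suc t) (fibWords-≥ (suc f) (suc t) τ τ∈) t (ℕP.n<1+n t))

  fibWords-deficit-swapped : ∀ f → FibWordsDeficit f → ∀ t τ → τ ∈ fibWords f (suc (suc t)) → t + suc (suc f) ≡ suc R → 1 ≤ t →
    ∀ π → AgreesFrom π (t ∷ τ) t → Deficit π t 0 → Deficits≤1From π t
  fibWords-deficit-swapped f next t τ τ∈ e 1≤t π agree def = from
    where
    t<R : t < R
    t<R = fuel-< e
    t+2≤τ : All (suc (suc t) ≤_) τ
    t+2≤τ = fibWords-≥ f (suc (suc t)) τ τ∈
    eₜ : π t ≡ (true , suc t)
    eₜ = trans (agree t ℕP.≤-refl (ℕP.<⇒≤ t<R)) (perm-swapped-left t<R t+2≤τ)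
    eₜ₊₁ : π (suc t) ≡ (true , t)
    eₜ₊₁ = trans (agree (suc t) (ℕP.n≤1+n t) t<R) (perm-swapped-right t<R t+2≤τ)
    def₁ : Deficit π (suc t) 1
    def₁ = deficit-forward π t 1 eₜ (ℕP.+-comm t 1) 1≤t t<R def
    def₂ : Deficit π (suc (suc t)) 0
    def₂ = deficit-backward π (suc t) 1 eₜ₊₁ (ℕP.+-comm t 1) 1≤t t<R def₁
    agree₂ : AgreesFrom π τ (suc (suc t))
    agree₂ i t+2≤i i≤R = trans (agree i (ℕP.≤-trans (ℕP.n≤1+n t) (ℕP.≤-trans (ℕP.n≤1+n (suc t)) t+2≤i)) i≤R)
                               (perm-swapped-beyond {τ = τ} t<R i t+2≤i)
    from : Deficits≤1From π t
    from s t≤s s≤R+1 with ℕP.m≤n⇒m<n∨m≡n t≤s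
    ... | inj₂ refl = deficit⇒atMost π t def z≤n
    ... | inj₁ t<s with ℕP.m≤n⇒m<n∨m≡n t<s
    ... | inj₂ refl = deficit⇒atMost π (suc t) def₁ ℕP.≤-refl
    ... | inj₁ t+1<s = next (suc (suc t)) τ τ∈ (fuel-shift {suc t} (fuel-shift {t} e)) (s≤s z≤n) π agree₂ def₂ s t+1<s s≤R+1

  -- The converse of classifyTail.
  fibWords-deficit : ∀ f → FibWordsDeficit f
  fibWords-deficit zero t _ _ e _ π _ def s t≤s s≤R+1 =
    subst (λ s → DeficitAtMost π s 1) (ℕP.≤-antisym t≤s (subst (s ≤_) (trans (sym e) (ℕP.+-identityʳ t)) s≤R+1)) (deficit⇒atMost π t def z≤n)
  fibWords-deficit (suc zero) t τ τ∈ e 1≤t π agree def s t≤s s≤R+1 with fuel-last e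
  ... | refl with ℕP.m≤n⇒m<n∨m≡n t≤s
  ... | inj₂ refl = deficit⇒atMost π R def z≤n
  ... | inj₁ R<s rewrite ℕP.≤-antisym s≤R+1 R<s =
    let b , e′ = perm-fibWords₁ τ∈ in beyond-last π b 1≤t (trans (agree R ℕP.≤-refl ℕP.≤-refl) e′) def
  fibWords-deficit (suc (suc f)) t τ τ∈ e 1≤t π agree def =
    fibWords-elim f t (λ τ → AgreesFrom π τ t → Deficit π t 0 → Deficits≤1From π t)
      (λ τ τ∈ → fibWords-deficit-fixed f (fibWords-deficit (suc f)) t τ τ∈ e π)
      (λ τ τ∈ → fibWords-deficit-swapped f (fibWords-deficit f) t τ τ∈ e 1≤t π) τ τ∈ agree def

  allWords-elim : (P : List ℕ → Set) → (∀ τ → τ ∈ fibWords (R ∸ 1) 2 → P τ) → (∀ τ → τ ∈ fibWords (R ∸ 2) 3 → P (1 ∷ τ)) →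
    (∀ τ → τ ∈ fibWords (R ∸ 3) 4 → P (1 ∷ 2 ∷ τ)) → ∀ τ → τ ∈ allWords → P τ
  allWords-elim P P₁ P₂ P₃ τ τ∈ with ∈-++⁻ (fibWords (R ∸ 1) 2) τ∈
  ... | inj₁ τ∈₁ = P₁ τ τ∈₁
  ... | inj₂ τ∈′ with ∈-++⁻ (map (1 ∷_) (fibWords (R ∸ 2) 3)) τ∈′
  ... | inj₁ τ∈₂ = let τ′ , τ′∈ , τ≡ = ∈-map⁻ (1 ∷_) τ∈₂ in subst P (sym τ≡) (P₂ τ′ τ′∈)
  ... | inj₂ τ∈₃ = let τ′ , τ′∈ , τ≡ = ∈-map⁻ (λ τ → 1 ∷ 2 ∷ τ) τ∈₃ in subst P (sym τ≡) (P₃ τ′ τ′∈)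

  headBound : ℕ → ℕ
  headBound 1 = 0
  headBound 2 = 2
  headBound _ = 1

  Deficits≤headBound : (ℕ → SignedIndex) → Set
  Deficits≤headBound π = ∀ s → 1 ≤ s → s ≤ suc R → DeficitAtMost π s (headBound s)

  tail⇒headBound : ∀ π t → Deficits≤1From π t → ∀ s → 2 ≤ s → t ≤ s → s ≤ suc R → DeficitAtMost π s (headBound s)
  tail⇒headBound π t tail 1 (s≤s ()) _ _
  tail⇒headBound π t tail s@(suc (suc s′)) _ t≤s s≤R+1 = atMost-mono π s (1≤headBound s′) (tail s t≤s s≤R+1)
    where
    1≤headBound : ∀ s′ → 1 ≤ headBound (suc (suc s′))
    1≤headBound zero = s≤s z≤n
    1≤headBound (suc _) = ℕP.≤-refl


  fibWords-< : ∀ f t τ → τ ∈ fibWords f t → t + f ≡ suc R → All (_< suc R) τ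
  fibWords-< zero t .[] (here refl) _ = []
  fibWords-< (suc zero) t .[] (here refl) _ = []
  fibWords-< (suc zero) t .(t ∷ []) (there (here refl)) e = s≤s (ℕP.≤-reflexive (fuel-last e)) ∷ []
  fibWords-< (suc (suc f)) t τ τ∈ e = fibWords-elim f t (All (_< suc R))
    (λ τ τ∈ → fibWords-< (suc f) (suc t) τ τ∈ (fuel-shift {t} e))
    (λ τ τ∈ → ℕP.m<n⇒m<1+n (fuel-< e) ∷ fibWords-< f (suc (suc t)) τ τ∈ (fuel-shift {suc t} (fuel-shift {t} e))) τ τ∈

  Separated : List ℕ → List ℕ → Set
  Separated τ τ′ = ∃[ m ] (m ≤ R × perm τ m ≢ perm τ′ m)

  separated-at : ∀ τ τ′ {m b p b′ p′} → m ≤ R → perm τ m ≡ (b , p) → perm τ′ m ≡ (b′ , p′) → p ≢ p′ → Separated τ τ′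
  separated-at τ τ′ {m} m≤R e e′ p≢p′ = m , m≤R , λ same → p≢p′ (cong index (trans (sym e) (trans same e′)))

  separated-prefix : ∀ a → a < R → ∀ {τ τ′} → Separated τ τ′ → Separated (a ∷ τ) (a ∷ τ′)
  separated-prefix a a<R {τ} {τ′} (m , m≤R , differ) =
    swapAdj a m , ℕP.≤-pred (swapAdj-< a m (s≤s a<R) (s≤s m≤R)) , λ same → differ (begin
      perm τ m                           ≡⟨ cong (perm τ) (sym (swapAdj-involutive a m)) ⟩
      perm τ (swapAdj a (swapAdj a m))   ≡⟨ sym (perm-swap a τ (swapAdj a m) a<R) ⟩
      perm (a ∷ τ) (swapAdj a m)         ≡⟨ same ⟩
      perm (a ∷ τ′) (swapAdj a m)        ≡⟨ perm-swap a τ′ (swapAdj a m) a<R ⟩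
      perm τ′ (swapAdj a (swapAdj a m))  ≡⟨ cong (perm τ′) (swapAdj-involutive a m) ⟩
      perm τ′ m                          ∎)
    where open ≡-Reasoning

  -- Distinct words of fibWords f t are told apart by the first position they treat differently.
  fibWords-separated : ∀ f t → t + f ≡ suc R → AllPairs Separated (fibWords f t)
  fibWords-separated zero t e = [] ∷ []
  fibWords-separated (suc zero) t e with fuel-last e
  ... | refl = ((R , ℕP.≤-refl , λ same → signs-differ (cong proj₁ (trans (sym (perm-lastWord true)) (trans same (perm-lastWord false)))))
                ∷ []) ∷ [] ∷ []
    where
    signs-differ : true ≢ false
    signs-differ ()
  fibWords-separated (suc (suc f)) t e = AllPairsP.++⁺ (fibWords-separated (suc f) (suc t) (fuel-shift {t} e))
    (AllPairsP.map⁺ (AllPairs.map (λ {τ} {τ′} → separated-prefix t t<R {τ} {τ′}) (fibWords-separated f (suc (suc t)) (fuel-shift {suc t} (fuel-shift {t} e)))))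
    (All.tabulate λ {x} x∈ → All.tabulate λ {y} y∈ → fixed-vs-swapped x x∈ y y∈)
    where
    t<R : t < R
    t<R = fuel-< e
    fixed-vs-swapped : ∀ x → x ∈ fibWords (suc f) (suc t) → ∀ y → y ∈ map (t ∷_) (fibWords f (suc (suc t))) → Separated x y
    fixed-vs-swapped x x∈ y y∈ with ∈-map⁻ (t ∷_) y∈
    ... | y′ , y′∈ , refl = separated-at x (t ∷ y′) (ℕP.<⇒≤ t<R)
      (perm-below x (suc t) (fibWords-≥ (suc f) (suc t) x x∈) t (ℕP.n<1+n t))
      (perm-swapped-left t<R (fibWords-≥ f (suc (suc t)) y′ y′∈)) (ℕP.<⇒≢ (ℕP.n<1+n t))

  module _ (3≤R : 3 ≤ R) where

    private
      1≤R : 1 ≤ R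
      1≤R = ℕP.≤-trans (s≤s z≤n) 3≤R
      2≤R : 2 ≤ R
      2≤R = ℕP.≤-trans (s≤s (s≤s z≤n)) 3≤R

    identityHead-deficit : ∀ τ → τ ∈ fibWords (R ∸ 1) 2 → Deficits≤headBound (perm τ)
    identityHead-deficit τ τ∈ = λ where
        1 _ _ → deficit⇒atMost π 1 def₁ z≤n
        s@(suc (suc _)) _ s≤R+1 → tail⇒headBound π 2 tail s (s≤s (s≤s z≤n)) (s≤s (s≤s z≤n)) s≤R+1
      where
      π : ℕ → SignedIndex
      π = perm τ
      2≤τ : All (2 ≤_) τ
      2≤τ = fibWords-≥ (R ∸ 1) 2 τ τ∈
      def₁ : Deficit π 1 0
      def₁ = deficit-fixed π 0 (perm-below τ 2 2≤τ 0 (s≤s z≤n)) refl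
      def₂ : Deficit π 2 0
      def₂ = deficit-fixed π 1 (perm-below τ 2 2≤τ 1 ℕP.≤-refl) def₁
      tail : Deficits≤1From π 2
      tail = fibWords-deficit (R ∸ 1) 2 τ τ∈ (fuel 1 1≤R) (s≤s z≤n) π (λ _ _ _ → refl) def₂

    swapHead-deficit : ∀ τ → τ ∈ fibWords (R ∸ 2) 3 → Deficits≤headBound (perm (1 ∷ τ))
    swapHead-deficit τ τ∈ = λ where
        1 _ _ → deficit⇒atMost π 1 def₁ z≤n
        2 _ _ → deficit⇒atMost π 2 def₂ (s≤s z≤n)
        s@(suc (suc (suc _))) _ s≤R+1 → tail⇒headBound π 3 tail s (s≤s (s≤s z≤n)) (s≤s (s≤s (s≤s z≤n))) s≤R+1
      where
      π : ℕ → SignedIndex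
      π = perm (1 ∷ τ)
      3≤τ : All (3 ≤_) τ
      3≤τ = fibWords-≥ (R ∸ 2) 3 τ τ∈
      def₁ : Deficit π 1 0
      def₁ = deficit-fixed π 0 (trans (perm-swap 1 τ 0 2≤R) (perm-below τ 3 3≤τ 0 (s≤s z≤n))) refl
      def₂ : Deficit π 2 1
      def₂ = deficit-forward π 1 1 (perm-swapped-left 2≤R 3≤τ) refl (s≤s z≤n) 2≤R def₁
      def₃ : Deficit π 3 0
      def₃ = deficit-backward π 2 1 (perm-swapped-right 2≤R 3≤τ) refl (s≤s z≤n) 2≤R def₂
      tail : Deficits≤1From π 3
      tail = fibWords-deficit (R ∸ 2) 3 τ τ∈ (fuel 2 2≤R) (s≤s z≤n) π (λ i 3≤i _ → perm-swapped-beyond {τ = τ} 2≤R i 3≤i) def₃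

    cycleHead-deficit : ∀ τ → τ ∈ fibWords (R ∸ 3) 4 → Deficits≤headBound (perm (1 ∷ 2 ∷ τ))
    cycleHead-deficit τ τ∈ = λ where
        1 _ _ → deficit⇒atMost π 1 def₁ z≤n
        2 _ _ → deficit⇒atMost π 2 def₂ ℕP.≤-refl
        3 _ _ → deficit⇒atMost π 3 def₃ ℕP.≤-refl
        s@(suc (suc (suc (suc _)))) _ s≤R+1 → tail⇒headBound π 4 tail s (s≤s (s≤s z≤n)) (s≤s (s≤s (s≤s (s≤s z≤n)))) s≤R+1
      where
      π : ℕ → SignedIndex
      π = perm (1 ∷ 2 ∷ τ)
      value : ∀ i → i < 4 → π i ≡ (true , swapAdj 2 (swapAdj 1 i))
      value = perm-cycle-below τ 3≤R (fibWords-≥ (R ∸ 3) 4 τ τ∈)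
      def₁ : Deficit π 1 0
      def₁ = deficit-fixed π 0 (value 0 (s≤s z≤n)) refl
      def₂ : Deficit π 2 2
      def₂ = deficit-forward π 1 2 (value 1 (s≤s (s≤s z≤n))) refl (s≤s z≤n) 3≤R def₁
      def₃ : Deficit π 3 1
      def₃ = deficit-backward π 2 1 (value 2 (s≤s (s≤s (s≤s z≤n)))) refl (s≤s z≤n) 2≤R def₂
      def₄ : Deficit π 4 0
      def₄ = deficit-backward π 3 1 (value 3 ℕP.≤-refl) refl (s≤s z≤n) 3≤R def₃
      tail : Deficits≤1From π 4
      tail = fibWords-deficit (R ∸ 3) 4 τ τ∈ (fuel 3 3≤R) (s≤s z≤n) π (λ i 4≤i _ → perm-cycle-beyond τ 3≤R i 4≤i) def₄

    allWords-deficit : ∀ τ → τ ∈ allWords → Deficits≤headBound (perm τ)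
    allWords-deficit = allWords-elim (λ τ → Deficits≤headBound (perm τ)) identityHead-deficit swapHead-deficit cycleHead-deficit

    allWords-< : ∀ τ → τ ∈ allWords → All (_< suc R) τ
    allWords-< = allWords-elim (All (_< suc R))
      (λ τ τ∈ → fibWords-< (R ∸ 1) 2 τ τ∈ (fuel 1 1≤R))
      (λ τ τ∈ → s≤s 1≤R ∷ fibWords-< (R ∸ 2) 3 τ τ∈ (fuel 2 2≤R))
      (λ τ τ∈ → s≤s 1≤R ∷ s≤s 2≤R ∷ fibWords-< (R ∸ 3) 4 τ τ∈ (fuel 3 3≤R))

    allWords-separated : AllPairs Separated allWords
    allWords-separated = AllPairsP.++⁺ (fibWords-separated (R ∸ 1) 2 (fuel 1 1≤R))
      (AllPairsP.++⁺ (AllPairsP.map⁺ (AllPairs.map (λ {τ} {τ′} → separated-prefix 1 2≤R {τ} {τ′}) (fibWords-separated (R ∸ 2) 3 (fuel 2 2≤R))))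
                     (AllPairsP.map⁺ (AllPairs.map (λ {τ} {τ′} sep → separated-prefix 1 2≤R {2 ∷ τ} {2 ∷ τ′} (separated-prefix 2 3≤R {τ} {τ′} sep))
                                                    (fibWords-separated (R ∸ 3) 4 (fuel 3 3≤R))))
                     (All.tabulate λ {x} x∈ → All.tabulate λ {y} y∈ → swap-vs-cycle x x∈ y y∈))
      (All.tabulate λ {x} x∈ → All.tabulate λ {y} y∈ → identity-vs-rest x x∈ y y∈)
      where
      at-identity : ∀ x → x ∈ fibWords (R ∸ 1) 2 → perm x 1 ≡ (true , 1)
      at-identity x x∈ = perm-below x 2 (fibWords-≥ (R ∸ 1) 2 x x∈) 1 ℕP.≤-refl
      at-swap : ∀ x → x ∈ fibWords (R ∸ 2) 3 → perm (1 ∷ x) 1 ≡ (true , 2)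
      at-swap x x∈ = perm-swapped-left 2≤R (fibWords-≥ (R ∸ 2) 3 x x∈)
      at-cycle : ∀ x → x ∈ fibWords (R ∸ 3) 4 → perm (1 ∷ 2 ∷ x) 1 ≡ (true , 3)
      at-cycle x x∈ = perm-cycle-below x 3≤R (fibWords-≥ (R ∸ 3) 4 x x∈) 1 (s≤s (s≤s z≤n))
      swap-vs-cycle : ∀ x → x ∈ map (1 ∷_) (fibWords (R ∸ 2) 3) → ∀ y → y ∈ map (λ τ → 1 ∷ 2 ∷ τ) (fibWords (R ∸ 3) 4) → Separated x y
      swap-vs-cycle x x∈ y y∈ with ∈-map⁻ (1 ∷_) x∈ | ∈-map⁻ (λ τ → 1 ∷ 2 ∷ τ) y∈
      ... | x′ , x′∈ , refl | y′ , y′∈ , refl = separated-at (1 ∷ x′) (1 ∷ 2 ∷ y′) 1≤R (at-swap x′ x′∈) (at-cycle y′ y′∈) (λ ())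
      identity-vs-rest : ∀ x → x ∈ fibWords (R ∸ 1) 2 → ∀ y → y ∈ map (1 ∷_) (fibWords (R ∸ 2) 3) ++ map (λ τ → 1 ∷ 2 ∷ τ) (fibWords (R ∸ 3) 4) →
        Separated x y
      identity-vs-rest x x∈ y y∈ with ∈-++⁻ (map (1 ∷_) (fibWords (R ∸ 2) 3)) y∈
      ... | inj₁ y∈₂ = let y′ , y′∈ , y≡ = ∈-map⁻ (1 ∷_) y∈₂ in
        subst (Separated x) (sym y≡) (separated-at x (1 ∷ y′) 1≤R (at-identity x x∈) (at-swap y′ y′∈) (λ ()))
      ... | inj₂ y∈₃ = let y′ , y′∈ , y≡ = ∈-map⁻ (λ τ → 1 ∷ 2 ∷ τ) y∈₃ in
        subst (Separated x) (sym y≡) (separated-at x (1 ∷ 2 ∷ y′) 1≤R (at-identity x x∈) (at-cycle y′ y′∈) (λ ()))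

length-fibWords : ∀ R ℓ f t → length (Deficits.fibWords R ℓ f t) ≡ fib (suc (suc f))
length-fibWords R ℓ zero t = refl
length-fibWords R ℓ (suc zero) t = refl
length-fibWords R ℓ (suc (suc f)) t = begin
  length (fibWords (suc f) (suc t) ++ map (t ∷_) (fibWords f (suc (suc t))))
    ≡⟨ ListP.length-++ (fibWords (suc f) (suc t)) ⟩
  length (fibWords (suc f) (suc t)) Nat.+ length (map (t ∷_) (fibWords f (suc (suc t))))
    ≡⟨ cong₂ Nat._+_ (length-fibWords R ℓ (suc f) (suc t))
                     (trans (ListP.length-map (t ∷_) (fibWords f (suc (suc t)))) (length-fibWords R ℓ f (suc (suc t)))) ⟩
  fib (suc (suc (suc f))) Nat.+ fib (suc (suc f)) ∎
  where
  open ≡-Reasoning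
  open Deficits R ℓ using (fibWords)

module WeightCoordinates where

  open Nat using (_<_; _≤_; _∸_; _≤?_)
  open Rat using (_+_; _*_)

  -- Coefficient of ε_p in c·ϖ_q (for q < r).
  ϖcoeff : ℕ → ℕ → ℕ → ℕ
  ϖcoeff q c p = if p <ᵇ q then c else 0

  coord-·ϖ : ∀ r c q p → p < r → (q ≡ᵇ r) ≡ false → coord (ℕtoℚ c · ϖ r q) p ≡ ℕtoℚ (ϖcoeff q c p)
  coord-·ϖ r c q p p<r q≢r = begin
    coord (ℕtoℚ c · ϖ r q) p                                        ≡⟨ coord-map (ℕtoℚ c *_) (ϖ r q) p p<r ⟩
    ℕtoℚ c * coord (ϖ r q) p                                        ≡⟨ cong (ℕtoℚ c *_) (coord-tabulate (λ m → if q ≡ᵇ r then ½ else indicator (m <ᵇ q)) p p<r) ⟩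
    ℕtoℚ c * (if q ≡ᵇ r then ½ else (if p <ᵇ q then 1ℚ else 0ℚ))   ≡⟨ cong (λ b → ℕtoℚ c * (if b then ½ else indicator (p <ᵇ q))) q≢r ⟩
    ℕtoℚ c * indicator (p <ᵇ q)                                     ≡⟨ scale (p <ᵇ q) ⟩
    ℕtoℚ (ϖcoeff q c p)                                              ∎
    where
    open ≡-Reasoning
    scale : ∀ b → ℕtoℚ c * indicator b ≡ ℕtoℚ (if b then c else 0)
    scale true = ℚP.*-identityʳ (ℕtoℚ c)
    scale false = ℚP.*-zeroʳ (ℕtoℚ c)

  coord-ρsum : ∀ r k p → k < r → p < r → coord (ρsum r k) p ≡ ℕtoℚ (k ∸ p)
  coord-ρsum r zero p _ _ rewrite coord-𝟘 {r} p | ℕP.0∸n≡0 p = refl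
  coord-ρsum r (suc k) p k<r p<r = begin
    coord (ϖ r (suc k) ⊕ ρsum r k) p                  ≡⟨ coord-⊕ (ϖ r (suc k)) (ρsum r k) p ⟩
    coord (ϖ r (suc k)) p + coord (ρsum r k) p        ≡⟨ cong₂ _+_ (trans (coord-tabulate (λ m → if suc k ≡ᵇ r then ½ else indicator (m <ᵇ suc k)) p p<r)
                                                                              (cong (λ b → if b then ½ else indicator (p <ᵇ suc k)) k+1≢r))
                                                                    (coord-ρsum r k p (ℕP.<-trans (ℕP.n<1+n k) k<r) p<r) ⟩
    indicator (p <ᵇ suc k) + ℕtoℚ (k ∸ p)             ≡⟨ step ⟩
    ℕtoℚ (suc k ∸ p)                                  ∎
    where
    open ≡-Reasoning
    k+1≢r : (suc k ≡ᵇ r) ≡ false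
    k+1≢r = ≢⇒≡ᵇ-false (ℕP.<⇒≢ k<r)
    step : indicator (p <ᵇ suc k) + ℕtoℚ (k ∸ p) ≡ ℕtoℚ (suc k ∸ p)
    step with p ≤? k
    ... | yes p≤k rewrite <⇒<ᵇ-true (s≤s p≤k) | ℕP.+-∸-assoc 1 p≤k = sym (ℕtoℚ-+ 1 (k ∸ p))
    ... | no p≰k rewrite ≥⇒<ᵇ-false {p} {suc k} (ℕP.≰⇒> p≰k) | ℕP.m≤n⇒m∸n≡0 (ℕP.<⇒≤ (ℕP.≰⇒> p≰k)) | ℕP.m≤n⇒m∸n≡0 (ℕP.≰⇒> p≰k) = refl

  coord-ρ : ∀ R p → p < suc R → coord (ρ (suc R)) p ≡ ½ + ℕtoℚ (R ∸ p)
  coord-ρ R p p<r = begin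
    coord (ϖ (suc R) (suc R) ⊕ ρsum (suc R) R) p           ≡⟨ coord-⊕ (ϖ (suc R) (suc R)) (ρsum (suc R) R) p ⟩
    coord (ϖ (suc R) (suc R)) p + coord (ρsum (suc R) R) p  ≡⟨ cong₂ _+_ (trans (coord-tabulate (λ m → if suc R ≡ᵇ suc R then ½ else indicator (m <ᵇ suc R)) p p<r)
                                                                                    (cong (λ b → if b then ½ else indicator (p <ᵇ suc R)) (≡ᵇ-refl R)))
                                                                        (coord-ρsum (suc R) R p (ℕP.n<1+n R) p<r) ⟩
    ½ + ℕtoℚ (R ∸ p)                                       ∎
    where open ≡-Reasoning

  ℕtoℚ-+½ : ∀ a b → ℕtoℚ a + (½ + ℕtoℚ b) ≡ ℕtoℚ (a Nat.+ b) + ½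
  ℕtoℚ-+½ a b = trans (solve 3 (λ x h y → x :+ (h :+ y) := (x :+ y) :+ h) refl (ℕtoℚ a) ½ (ℕtoℚ b)) (cong (_+ ½) (sym (ℕtoℚ-+ a b)))
    where open ℚ-Solver

open WeightCoordinates

allPairs-map⁺ : ∀ {A B : Set} {P : A → Set} {_~_ : A → A → Set} {_≈_ : B → B → Set} (f : A → B) →
  (∀ {x y} → P x → P y → x ~ y → f x ≈ f y) → ∀ {xs} → All P xs → AllPairs _~_ xs → AllPairs _≈_ (map f xs)
allPairs-map⁺ f g [] [] = []
allPairs-map⁺ {P = P} {_~_} {_≈_} f g {x ∷ xs} (px ∷ pxs) (x~xs ∷ ~xs) = go pxs x~xs ∷ allPairs-map⁺ f g pxs ~xs
  where
  go : ∀ {ys} → All P ys → All (x ~_) ys → All (f x ≈_) (map f ys)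
  go [] [] = []
  go (py ∷ pys) (x~y ∷ x~ys) = g px py x~y ∷ go pys x~ys

module Corollary (q ℓ j k : ℕ) (0<k : 0 Nat.< k) (ℓ-large : 1 Nat.+ 4 Nat.* j Nat.+ 6 Nat.* k Nat.≤ ℓ) where

  open Nat using (_+_; _*_; _∸_; _<_; _≤_)
  open Rat using (_-_) renaming (_+_ to _+ℚ_; _≤_ to _≤ℚ_; -_ to -ℚ_)

  R r : ℕ
  R = suc (suc (suc q))
  r = suc R

  3≤R : 3 ≤ R
  3≤R = s≤s (s≤s (s≤s z≤n))

  open Deficits R ℓ

  m₀ : ℕ
  m₀ = ℓ ∸ 1 ∸ 4 * j ∸ 6 * k

  λ′ μ′ : V r
  λ′ = ℕtoℚ ℓ · ϖ r 1
  μ′ = (ℕtoℚ m₀ · ϖ r 1) ⊕ ((ℕtoℚ (2 * j) · ϖ r 2) ⊕ (ℕtoℚ (2 * k) · ϖ r 3))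

  -- (μ+ρ)_p = νμ p + ½, as (λ+ρ)_p = ν p + ½.
  νμ : ℕ → ℕ
  νμ p = (ϖcoeff 1 m₀ p + (ϖcoeff 2 (2 * j) p + ϖcoeff 3 (2 * k) p)) + (R ∸ p)

  coord-λ+ρ : ∀ p → p < r → coord (λ′ ⊕ ρ r) p ≡ ℕtoℚ (ν p) +ℚ ½
  coord-λ+ρ p p<r = begin
    coord (λ′ ⊕ ρ r) p                            ≡⟨ coord-⊕ λ′ (ρ r) p ⟩
    coord λ′ p +ℚ coord (ρ r) p                   ≡⟨ cong₂ _+ℚ_ (coord-·ϖ r ℓ 1 p p<r refl) (coord-ρ R p p<r) ⟩
    ℕtoℚ (ϖcoeff 1 ℓ p) +ℚ (½ +ℚ ℕtoℚ (R ∸ p))   ≡⟨ ℕtoℚ-+½ (ϖcoeff 1 ℓ p) (R ∸ p) ⟩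
    ℕtoℚ (ϖcoeff 1 ℓ p + (R ∸ p)) +ℚ ½           ≡⟨ cong (λ n → ℕtoℚ n +ℚ ½) (ν-as-ϖcoeff p) ⟩
    ℕtoℚ (ν p) +ℚ ½                               ∎
    where
    open ≡-Reasoning
    ν-as-ϖcoeff : ∀ p → ϖcoeff 1 ℓ p + (R ∸ p) ≡ ν p
    ν-as-ϖcoeff zero = refl
    ν-as-ϖcoeff (suc p) = refl

  coord-μ+ρ : ∀ p → p < r → coord (μ′ ⊕ ρ r) p ≡ ℕtoℚ (νμ p) +ℚ ½
  coord-μ+ρ p p<r = begin
    coord (μ′ ⊕ ρ r) p               ≡⟨ coord-⊕ μ′ (ρ r) p ⟩
    coord μ′ p +ℚ coord (ρ r) p      ≡⟨ cong₂ _+ℚ_ coord-μ (coord-ρ R p p<r) ⟩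
    ℕtoℚ a +ℚ (½ +ℚ ℕtoℚ (R ∸ p))    ≡⟨ ℕtoℚ-+½ a (R ∸ p) ⟩
    ℕtoℚ (νμ p) +ℚ ½                 ∎
    where
    open ≡-Reasoning
    a : ℕ
    a = ϖcoeff 1 m₀ p + (ϖcoeff 2 (2 * j) p + ϖcoeff 3 (2 * k) p)
    coord-μ : coord μ′ p ≡ ℕtoℚ a
    coord-μ = begin
      coord μ′ p
        ≡⟨ trans (coord-⊕ (ℕtoℚ m₀ · ϖ r 1) ((ℕtoℚ (2 * j) · ϖ r 2) ⊕ (ℕtoℚ (2 * k) · ϖ r 3)) p) (cong (coord (ℕtoℚ m₀ · ϖ r 1) p +ℚ_) (coord-⊕ (ℕtoℚ (2 * j) · ϖ r 2) (ℕtoℚ (2 * k) · ϖ r 3) p)) ⟩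
      coord (ℕtoℚ m₀ · ϖ r 1) p +ℚ (coord (ℕtoℚ (2 * j) · ϖ r 2) p +ℚ coord (ℕtoℚ (2 * k) · ϖ r 3) p)
        ≡⟨ cong₂ _+ℚ_ (coord-·ϖ r m₀ 1 p p<r refl) (cong₂ _+ℚ_ (coord-·ϖ r (2 * j) 2 p p<r refl) (coord-·ϖ r (2 * k) 3 p p<r refl)) ⟩
      ℕtoℚ (ϖcoeff 1 m₀ p) +ℚ (ℕtoℚ (ϖcoeff 2 (2 * j) p) +ℚ ℕtoℚ (ϖcoeff 3 (2 * k) p))
        ≡⟨ sym (trans (ℕtoℚ-+ (ϖcoeff 1 m₀ p) _) (cong (ℕtoℚ (ϖcoeff 1 m₀ p) +ℚ_) (ℕtoℚ-+ (ϖcoeff 2 (2 * j) p) (ϖcoeff 3 (2 * k) p)))) ⟩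
      ℕtoℚ a ∎

  ξ : Word r → V r
  ξ σ = act r σ (λ′ ⊕ ρ r) ⊖ (μ′ ⊕ ρ r)

  permOf : Word r → ℕ → SignedIndex
  permOf σ = perm (map toℕ σ)

  letters-< : ∀ (σ : Word r) → All (_< r) (map toℕ σ)
  letters-< σ = AllP.map⁺ (All.universal FinP.toℕ<n σ)

  index-permOf-< : ∀ σ i → i < r → index (permOf σ i) < r
  index-permOf-< σ = signedPerm-index-< (map toℕ σ) (letters-< σ)

  coord-ξ : ∀ σ i → i < r → coord (ξ σ) i ≡ ℕtoℚ (posPart (permOf σ i)) - ℕtoℚ (negPart (permOf σ i) + νμ i)
  coord-ξ σ i i<r = begin
    coord (ξ σ) i                                                   ≡⟨ coord-⊖ (act r σ (λ′ ⊕ ρ r)) (μ′ ⊕ ρ r) i ⟩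
    coord (act r σ (λ′ ⊕ ρ r)) i - coord (μ′ ⊕ ρ r) i               ≡⟨ cong₂ _-_ (coord-act r σ (λ′ ⊕ ρ r) i i<r) (coord-μ+ρ i i<r) ⟩
    signedCoord (λ′ ⊕ ρ r) (permOf σ i) - (ℕtoℚ (νμ i) +ℚ ½)           ≡⟨ shifted (permOf σ i) (index-permOf-< σ i i<r) ⟩
    ℕtoℚ (posPart (permOf σ i)) - ℕtoℚ (negPart (permOf σ i) + νμ i)      ∎
    where
    open ≡-Reasoning
    open ℚ-Solver
    -- The two ½'s cancel for +ε_p and add up to 1 for −ε_p.
    shifted : ∀ x → index x < r → signedCoord (λ′ ⊕ ρ r) x - (ℕtoℚ (νμ i) +ℚ ½) ≡ ℕtoℚ (posPart x) - ℕtoℚ (negPart x + νμ i)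
    shifted (true , p) p<r = trans (cong (_- (ℕtoℚ (νμ i) +ℚ ½)) (coord-λ+ρ p p<r))
      (solve 3 (λ a b h → (a :+ h) :- (b :+ h) := a :- b) refl (ℕtoℚ (ν p)) (ℕtoℚ (νμ i)) ½)
    shifted (false , p) p<r = trans (cong (λ z → -ℚ z - (ℕtoℚ (νμ i) +ℚ ½)) (coord-λ+ρ p p<r))
      (trans (solve 3 (λ a b h → :- (a :+ h) :- (b :+ h) := con 0ℚ :- ((h :+ h) :+ (a :+ b))) refl (ℕtoℚ (ν p)) (ℕtoℚ (νμ i)) ½)
             (cong (0ℚ -_) (sym (trans (ℕtoℚ-+ 1 (ν p + νμ i)) (cong (1ℚ +ℚ_) (ℕtoℚ-+ (ν p) (νμ i)))))))

  Σνμ : ℕ → ℕ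
  Σνμ = sumBelow νμ

  prefixSum-ξ : ∀ σ t → t ≤ r → prefixSum t (ξ σ) ≡ ℕtoℚ (Σpos (permOf σ) t) - ℕtoℚ (Σneg (permOf σ) t + Σνμ t)
  prefixSum-ξ σ zero _ = refl
  prefixSum-ξ σ (suc t) t<r = begin
    prefixSum t (ξ σ) +ℚ coord (ξ σ) t
      ≡⟨ cong₂ _+ℚ_ (prefixSum-ξ σ t (ℕP.<⇒≤ t<r)) (coord-ξ σ t t<r) ⟩
    (ℕtoℚ P - ℕtoℚ N) +ℚ (ℕtoℚ a - ℕtoℚ b)
      ≡⟨ solve 4 (λ P N a b → (P :- N) :+ (a :- b) := (P :+ a) :- (N :+ b)) refl (ℕtoℚ P) (ℕtoℚ N) (ℕtoℚ a) (ℕtoℚ b) ⟩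
    (ℕtoℚ P +ℚ ℕtoℚ a) - (ℕtoℚ N +ℚ ℕtoℚ b)
      ≡⟨ sym (cong₂ _-_ (ℕtoℚ-+ P a) (ℕtoℚ-+ N b)) ⟩
    ℕtoℚ (P + a) - ℕtoℚ (N + b)
      ≡⟨ cong (λ n → ℕtoℚ (P + a) - ℕtoℚ n)
              (ℕ-Solver.solve 4 (λ x y z w → (x ℕ-Solver.:+ y) ℕ-Solver.:+ (z ℕ-Solver.:+ w) ℕ-Solver.:= (x ℕ-Solver.:+ z) ℕ-Solver.:+ (y ℕ-Solver.:+ w))
                 refl (Σneg (permOf σ) t) (Σνμ t) (negPart (permOf σ t)) (νμ t)) ⟩
    ℕtoℚ (Σpos (permOf σ) (suc t)) - ℕtoℚ (Σneg (permOf σ) (suc t) + Σνμ (suc t)) ∎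
    where
    open ≡-Reasoning
    open ℚ-Solver
    P N a b : ℕ
    P = Σpos (permOf σ) t
    N = Σneg (permOf σ) t + Σνμ t
    a = posPart (permOf σ t)
    b = negPart (permOf σ t) + νμ t

  -- slack s = Σν s − Σνμ s: how far the first s coordinates of μ + ρ lie below those of λ + ρ.
  slack : ℕ → ℕ
  slack 1 = 1 + (2 * j + 4 * k)
  slack 2 = 1 + 2 * k
  slack _ = 1

  m₀-complement : m₀ + (1 + 4 * j + 6 * k) ≡ ℓ
  m₀-complement = begin
    (ℓ ∸ 1 ∸ 4 * j ∸ 6 * k) + (1 + 4 * j + 6 * k)  ≡⟨ cong (_+ (1 + 4 * j + 6 * k)) (trans (ℕP.∸-+-assoc (ℓ ∸ 1) (4 * j) (6 * k))
                                                              (ℕP.∸-+-assoc ℓ 1 (4 * j + 6 * k))) ⟩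
    (ℓ ∸ (1 + (4 * j + 6 * k))) + (1 + 4 * j + 6 * k) ≡⟨ cong (λ n → (ℓ ∸ n) + (1 + 4 * j + 6 * k)) (sym (ℕP.+-assoc 1 (4 * j) (6 * k))) ⟩
    (ℓ ∸ (1 + 4 * j + 6 * k)) + (1 + 4 * j + 6 * k)   ≡⟨ ℕP.m∸n+n≡m ℓ-large ⟩
    ℓ                                                 ∎
    where open ≡-Reasoning

  Σνμ+slack : ∀ s → 1 ≤ s → Σνμ s + slack s ≡ Σν s
  Σνμ+slack 1 _ = trans
    (solve 4 (λ m x y d → (m :+ (con 2 :* x :+ con 2 :* y) :+ d) :+ (con 1 :+ (con 2 :* x :+ con 4 :* y))
                       := (m :+ (con 1 :+ con 4 :* x :+ con 6 :* y)) :+ d) refl m₀ j k R)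
    (cong (_+ R) m₀-complement)
    where open ℕ-Solver
  Σνμ+slack 2 _ = trans
    (solve 5 (λ m x y d e → ((m :+ (con 2 :* x :+ con 2 :* y) :+ d) :+ ((con 2 :* x :+ con 2 :* y) :+ e)) :+ (con 1 :+ con 2 :* y)
                         := ((m :+ (con 1 :+ con 4 :* x :+ con 6 :* y)) :+ d) :+ e) refl m₀ j k R (R ∸ 1))
    (cong (λ n → (n + R) + (R ∸ 1)) m₀-complement)
    where open ℕ-Solver
  Σνμ+slack (suc (suc (suc t))) _ = beyond t
    where
    open ℕ-Solver
    beyond : ∀ t → Σνμ (3 + t) + 1 ≡ Σν (3 + t)
    beyond zero = trans
      (solve 6 (λ m x y d e f → ((m :+ (con 2 :* x :+ con 2 :* y) :+ d) :+ ((con 2 :* x :+ con 2 :* y) :+ e) :+ (con 2 :* y :+ f)) :+ con 1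
                             := ((m :+ (con 1 :+ con 4 :* x :+ con 6 :* y)) :+ d) :+ e :+ f) refl m₀ j k R (R ∸ 1) (R ∸ 2))
      (cong (λ n → (n + R) + (R ∸ 1) + (R ∸ 2)) m₀-complement)
    beyond (suc t) = trans (solve 2 (λ a b → (a :+ b) :+ con 1 := (a :+ con 1) :+ b) refl (Σνμ (3 + t)) (νμ (3 + t)))
                           (cong (_+ ν (3 + t)) (beyond t))

  nonneg⇒deficit : ∀ π s → 1 ≤ s → Σneg π s + Σνμ s ≤ Σpos π s → DeficitAtMost π s (slack s)
  nonneg⇒deficit π s 1≤s h = subst (_≤ Σpos π s + slack s) (trans (ℕP.+-assoc (Σneg π s) _ _) (cong (Σneg π s +_) (Σνμ+slack s 1≤s)))
    (ℕP.+-monoˡ-≤ (slack s) h)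

  deficit⇒nonneg : ∀ π s → 1 ≤ s → DeficitAtMost π s (slack s) → Σneg π s + Σνμ s ≤ Σpos π s
  deficit⇒nonneg π s 1≤s h = ℕP.+-cancelʳ-≤ (slack s) _ _
    (subst (_≤ Σpos π s + slack s) (sym (trans (ℕP.+-assoc (Σneg π s) _ _) (cong (Σneg π s +_) (Σνμ+slack s 1≤s)))) h)

  InA⇒deficits : ∀ σ → InA r λ′ μ′ σ → ∀ s → 1 ≤ s → s ≤ r → DeficitAtMost (permOf σ) s (slack s)
  InA⇒deficits σ kp s 1≤s s≤r = nonneg⇒deficit (permOf σ) s 1≤s (ℕtoℚ-∸-nonneg _ _
    (subst (0ℚ ≤ℚ_) (prefixSum-ξ σ s s≤r) (KostantPos⇒prefixSum-nonneg (ξ σ) kp s)))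

  deficits⇒InA : ∀ σ → (∀ s → 1 ≤ s → s ≤ r → DeficitAtMost (permOf σ) s (slack s)) → InA r λ′ μ′ σ
  deficits⇒InA σ bounds = prefixSum-ℕ⇒KostantPos (ξ σ) c λ t t<r →
    trans (prefixSum-ξ σ (suc t) t<r) (ℕtoℚ-∸ _ _ (deficit⇒nonneg (permOf σ) (suc t) (s≤s z≤n) (bounds (suc t) (s≤s z≤n) t<r)))
    where
    c : ℕ → ℕ
    c t = Σpos (permOf σ) (suc t) ∸ (Σneg (permOf σ) (suc t) + Σνμ (suc t))

  slack₁<ℓ : slack 1 < ℓ
  slack₁<ℓ = ℕP.≤-trans (ℕP.+-cancelʳ-≤ 1 _ _ (ℕP.≤-trans (ℕP.+-monoʳ-≤ (suc (slack 1)) 1≤2j+2k) (ℕP.≤-reflexive regroup))) ℓ-large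
    where
    open ℕ-Solver
    1≤2j+2k : 1 ≤ 2 * j + 2 * k
    1≤2j+2k = ℕP.≤-trans 0<k (ℕP.≤-trans (ℕP.m≤m+n k (k + 0)) (ℕP.m≤n+m (2 * k) (2 * j)))
    regroup : suc (slack 1) + (2 * j + 2 * k) ≡ (1 + 4 * j + 6 * k) + 1
    regroup = solve 2 (λ x y → (con 1 :+ (con 1 :+ (con 2 :* x :+ con 4 :* y))) :+ (con 2 :* x :+ con 2 :* y)
                             := (con 1 :+ con 4 :* x :+ con 6 :* y) :+ con 1) refl j k

  headBound≤slack : ∀ s → headBound s ≤ slack s
  headBound≤slack 0 = ℕP.≤-refl
  headBound≤slack 1 = z≤n
  headBound≤slack 2 = s≤s (ℕP.≤-trans 0<k (ℕP.m≤m+n k (k + 0)))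
  headBound≤slack (suc (suc (suc s))) = ℕP.≤-refl

  admissible : ∀ σ → InA r λ′ μ′ σ → Admissible (permOf σ)
  admissible σ σ∈𝒜 = record
    { index-injective = signedPerm-index-injective r (map toℕ σ)
    ; index-≤ = λ i i≤R → ℕP.≤-pred (index-permOf-< σ i (s≤s i≤R))
    ; deficit-≤1 = λ where
        1 (s≤s ()) _
        2 (s≤s (s≤s ())) _
        s@(suc (suc (suc _))) _ s≤r → InA⇒deficits σ σ∈𝒜 s (s≤s z≤n) s≤r
    }

  toWord : List ℕ → Word r
  toWord = map (λ a → a DivModP.mod r)

  toℕ-toWord : ∀ τ → All (_< r) τ → map toℕ (toWord τ) ≡ τ
  toℕ-toWord [] [] = refl
  toℕ-toWord (a ∷ τ) (a<r ∷ τ<r) = cong₂ _∷_ (trans (FinP.toℕ-fromℕ< _) (DivModP.m<n⇒m%n≡m a<r)) (toℕ-toWord τ τ<r)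

  permOf-toWord : ∀ τ → τ ∈ allWords → permOf (toWord τ) ≡ perm τ
  permOf-toWord τ τ∈ = cong perm (toℕ-toWord τ (allWords-< 3≤R τ τ∈))

  𝒜-words : List (Word r)
  𝒜-words = map toWord allWords

  toWord-InA : ∀ τ → τ ∈ allWords → InA r λ′ μ′ (toWord τ)
  toWord-InA τ τ∈ = deficits⇒InA (toWord τ) λ s 1≤s s≤r → subst (λ π → DeficitAtMost π s (slack s)) (sym (permOf-toWord τ τ∈))
    (atMost-mono (perm τ) s (headBound≤slack s) (allWords-deficit 3≤R τ τ∈ s 1≤s s≤r))

  complete : ∀ σ → InA r λ′ μ′ σ → ∃[ w ] (w ∈ 𝒜-words × σ ≈W w)
  complete σ σ∈𝒜 =
    let τ , τ∈ , agree = classifyHead (admissible σ σ∈𝒜) 3≤R (fixes-first (permOf σ) (slack 1) slack₁<ℓ (InA⇒deficits σ σ∈𝒜 1 ℕP.≤-refl (s≤s z≤n)))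
    in toWord τ , ∈-map⁺ toWord τ∈ ,
       signedPerm⇒≈W r σ (toWord τ) λ m m<r → trans (agree m z≤n (ℕP.≤-pred m<r)) (cong (λ π → π m) (sym (permOf-toWord τ τ∈)))

  -- Evaluating at (1, 2, …, r) recovers the signed permutation from the Weyl group element.
  testVector : V r
  testVector = tabulate (λ i → ℕtoℚ (suc (toℕ i)))

  signedInt : SignedIndex → ℤ
  signedInt (true , p) = ℤ.+ (suc p)
  signedInt (false , p) = ℤ.-[1+ p ]

  signedInt-injective : ∀ x y → signedInt x ≡ signedInt y → x ≡ y
  signedInt-injective (true , p) (true , .p) refl = refl
  signedInt-injective (false , p) (false , .p) refl = refl

  signedCoord-testVector : ∀ x → index x < r → signedCoord testVector x ≡ ℤtoℚ (signedInt x)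
  signedCoord-testVector (true , p) p<r = coord-tabulate (λ m → ℕtoℚ (suc m)) p p<r
  signedCoord-testVector (false , p) p<r =
    trans (cong -ℚ_ (coord-tabulate (λ m → ℕtoℚ (suc m)) p p<r)) (sym (ℤtoℚ-neg (ℤ.+ (suc p))))

  separated⇒≉ : ∀ {x y} → x ∈ allWords → y ∈ allWords → Separated x y → ¬ (toWord x ≈W toWord y)
  separated⇒≉ {x} {y} x∈ y∈ (m , m≤R , differ) same = differ (signedInt-injective _ _ (ℤtoℚ-injective (begin
    ℤtoℚ (signedInt (perm x m))              ≡⟨ sym (at x x∈) ⟩
    coord (act r (toWord x) testVector) m    ≡⟨ cong (λ v → coord v m) (same testVector) ⟩
    coord (act r (toWord y) testVector) m    ≡⟨ at y y∈ ⟩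
    ℤtoℚ (signedInt (perm y m))              ∎)))
    where
    open ≡-Reasoning
    at : ∀ τ → τ ∈ allWords → coord (act r (toWord τ) testVector) m ≡ ℤtoℚ (signedInt (perm τ m))
    at τ τ∈ = trans (coord-act r (toWord τ) testVector m (s≤s m≤R))
      (trans (cong (λ π → signedCoord testVector (π m)) (permOf-toWord τ τ∈))
             (signedCoord-testVector (perm τ m) (subst (λ π → index (π m) < r) (permOf-toWord τ τ∈) (index-permOf-< (toWord τ) m (s≤s m≤R)))))

  𝒜-words-distinct : AllPairs (λ w w′ → ¬ (w ≈W w′)) 𝒜-words
  𝒜-words-distinct = allPairs-map⁺ toWord separated⇒≉ (All.tabulate (λ τ∈ → τ∈)) (allWords-separated 3≤R)

  length-𝒜-words : length 𝒜-words ≡ 2 * fib r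
  length-𝒜-words = begin
    length (map toWord allWords)       ≡⟨ ListP.length-map toWord allWords ⟩
    length allWords                    ≡⟨ ListP.length-++ (fibWords (R ∸ 1) 2) ⟩
    length (fibWords (R ∸ 1) 2) + length (map (1 ∷_) (fibWords (R ∸ 2) 3) ++ map (λ τ → 1 ∷ 2 ∷ τ) (fibWords (R ∸ 3) 4))
      ≡⟨ cong (length (fibWords (R ∸ 1) 2) +_) (ListP.length-++ (map (1 ∷_) (fibWords (R ∸ 2) 3))) ⟩
    length (fibWords (R ∸ 1) 2) + (length (map (1 ∷_) (fibWords (R ∸ 2) 3)) + length (map (λ τ → 1 ∷ 2 ∷ τ) (fibWords (R ∸ 3) 4)))
      ≡⟨ cong₂ _+_ (length-fibWords R ℓ (R ∸ 1) 2)
                   (cong₂ _+_ (trans (ListP.length-map (1 ∷_) (fibWords (R ∸ 2) 3)) (length-fibWords R ℓ (R ∸ 2) 3))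
                              (trans (ListP.length-map _ (fibWords (R ∸ 3) 4)) (length-fibWords R ℓ (R ∸ 3) 4))) ⟩
    fib r + (fib (suc R ∸ 1) + fib (suc R ∸ 2))  ≡⟨ cong (fib r +_) (sym (ℕP.+-identityʳ (fib r))) ⟩
    2 * fib r                                     ∎
    where open ≡-Reasoning

  cardA : CardA r λ′ μ′ (2 * fib r)
  cardA = 𝒜-words , length-𝒜-words , AllP.map⁺ (All.tabulate (λ {τ} → toWord-InA τ)) , 𝒜-words-distinct , complete

open import Data.Nat using (_+_; _*_; _∸_; _<_; _≤_; _%_)

corollary3p6 : (r ℓ j k : ℕ) → 3 < r → ℓ % 2 ≡ 1 → 0 < k → 1 + 4 * j + 6 * k ≤ ℓ →
    CardA r
      (ℕtoℚ ℓ · ϖ r 1)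
      ((ℕtoℚ (ℓ ∸ 1 ∸ 4 * j ∸ 6 * k) · ϖ r 1) ⊕ ((ℕtoℚ (2 * j) · ϖ r 2) ⊕ (ℕtoℚ (2 * k) · ϖ r 3)))
      (2 * fib r)
corollary3p6 (suc (suc (suc (suc q)))) ℓ j k _ _ 0<k ℓ-large = Corollary.cardA q ℓ j k 0<k ℓ-large
corollary3p6 (suc (suc (suc zero))) _ _ _ (s≤s (s≤s (s≤s ()))) _ _ _
corollary3p6 (suc (suc zero)) _ _ _ (s≤s (s≤s ())) _ _ _
corollary3p6 (suc zero) _ _ _ (s≤s ()) _ _ _
corollary3p6 zero _ _ _ () _ _ _
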